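{- The space $S_5\cong B^2(\Pi)$ of $5\times5$ Latin squares is regular (all vertex links are isomorphic), and for every vertex $p$ of $S_5$, $\mathrm{Link}(S_5,p)\cong B^2(\mathcal{I})$, where $\mathcal{I}$ is the icosahedron.
   Context: $S_5$ is the simplicial complex whose vertices are the subsets of the $5\times5$ grid meeting each row and each column in exactly one cell (identified with permutations of $\{1,\dots,5\}$) and whose 4-simplices are the partitions of the grid into five such subsets (Latin squares up to renaming symbols). For a simplicial complex $X$, a coloring is a map $f$ from its vertices to a set of colors with adjacent vertices colored differently (colorings differing by renaming colors identified), using $d+2$ colors for a $d$-dimensional complex (four colors for the icosahedron, five for $S_5$-type 4-complexes... ). $B(X)$ is the simplicial complex whose vertices are the distinct color classes $f^{ -1}(c)$ and whose maximal simplices are the sets of all color classes of a single coloring $f$; $B^2(X)=B(B(X))$. $\Pi$ denotes the 600-cell. -}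

module Defs where

open import Data.Nat using (ℕ)
open import Data.Fin as Fin using (Fin; zero; suc; #_)
open import Data.Bool using (Bool; true; false)
open import Data.List using (List; []; _∷_; map)
open import Data.List.Relation.Unary.All using (All)
open import Data.List.Membership.Propositional using (_∈_)
open import Data.Product using (Σ; ∃; ∃-syntax; _×_; _,_; proj₁; proj₂)
open import Relation.Nullary using (¬_; does)
open import Relation.Binary.PropositionalEquality using (_≡_; _≢_)
open import Function.Definitions using (Injective)

-- Abstract simplicial complexes, given by a vertex type with an
-- equality (setoid) and a face predicate on finite lists of vertices
-- (a list is a face iff its set of elements is a simplex).

record Complex : Set₁ where
  field
    V    : Set
    _≈_  : V → V → Set
    Face : List V → Set
open Complex public

record _≅_ (X Y : Complex) : Set where
  field
    to        : V X → V Y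
    from      : V Y → V X
    to-cong   : ∀ {x x′} → _≈_ X x x′ → _≈_ Y (to x) (to x′)
    from-cong : ∀ {y y′} → _≈_ Y y y′ → _≈_ X (from y) (from y′)
    from-to   : ∀ x → _≈_ X (from (to x)) x
    to-from   : ∀ y → _≈_ Y (to (from y)) y
    face-to   : ∀ σ → Face X σ → Face Y (map to σ)
    face-from : ∀ σ → Face Y (map to σ) → Face X σ

Link : (X : Complex) → V X → Complex
Link X p = record
  { V    = Σ (V X) (λ w → (¬ _≈_ X w p) × Face X (p ∷ w ∷ []))
  ; _≈_  = λ a b → _≈_ X (proj₁ a) (proj₁ b)
  ; Face = λ σ → Face X (p ∷ map proj₁ σ)
  }

Coloring : ℕ → Complex → Set
Coloring k X =
  Σ (V X → Fin k) λ f →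
    (∀ u v → _≈_ X u v → f u ≡ f v) ×
    (∀ u v → Face X (u ∷ v ∷ []) → ¬ _≈_ X u v → f u ≢ f v)

IsClassOf : ∀ {k X} → Coloring k X → (V X → Bool) → Set
IsClassOf {k} {X} f S =
  ∃[ c ] (∃[ v ] proj₁ f v ≡ c) × (∀ v → S v ≡ does (proj₁ f v Fin.≟ c))

-- B_k(X): vertices are the color classes of k-colorings of X;
-- maximal simplices are the sets of all color classes of one coloring,
-- faces are their subsets.
B : ℕ → Complex → Complex
B k X = record
  { V    = Σ (V X → Bool) (λ S → Σ (Coloring k X) (λ f → IsClassOf {k} {X} f S))
  ; _≈_  = λ S T → ∀ v → proj₁ S v ≡ proj₁ T v
  ; Face = λ σ → Σ (Coloring k X) (λ f → All (λ S → IsClassOf {k} {X} f (proj₁ S)) σ)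
  }

-- The icosahedron: vertex 0 (north pole), upper ring 1..5,
-- lower ring 6..10, vertex 11 (south pole); 20 triangles.

icosaTriangles : List (List (Fin 12))
icosaTriangles =
    (# 0 ∷ # 1 ∷ # 2 ∷ []) ∷ (# 0 ∷ # 2 ∷ # 3 ∷ []) ∷ (# 0 ∷ # 3 ∷ # 4 ∷ []) ∷ (# 0 ∷ # 4 ∷ # 5 ∷ []) ∷ (# 0 ∷ # 5 ∷ # 1 ∷ [])
  ∷ (# 11 ∷ # 6 ∷ # 7 ∷ []) ∷ (# 11 ∷ # 7 ∷ # 8 ∷ []) ∷ (# 11 ∷ # 8 ∷ # 9 ∷ []) ∷ (# 11 ∷ # 9 ∷ # 10 ∷ []) ∷ (# 11 ∷ # 10 ∷ # 6 ∷ [])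
  -- antiprism band: (uᵢ, uᵢ₊₁, lᵢ)
  ∷ (# 1 ∷ # 2 ∷ # 6 ∷ []) ∷ (# 2 ∷ # 3 ∷ # 7 ∷ []) ∷ (# 3 ∷ # 4 ∷ # 8 ∷ []) ∷ (# 4 ∷ # 5 ∷ # 9 ∷ []) ∷ (# 5 ∷ # 1 ∷ # 10 ∷ [])
  -- antiprism band: (lᵢ, lᵢ₊₁, uᵢ₊₁)
  ∷ (# 6 ∷ # 7 ∷ # 2 ∷ []) ∷ (# 7 ∷ # 8 ∷ # 3 ∷ []) ∷ (# 8 ∷ # 9 ∷ # 4 ∷ []) ∷ (# 9 ∷ # 10 ∷ # 5 ∷ []) ∷ (# 10 ∷ # 6 ∷ # 1 ∷ [])
  ∷ []

Icosahedron : Complex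
Icosahedron = record
  { V    = Fin 12
  ; _≈_  = _≡_
  ; Face = λ σ → ∃[ t ] (t ∈ icosaTriangles) × All (λ v → v ∈ t) σ
  }

-- S₅: vertices are the subsets of the 5×5 grid meeting every row and
-- column exactly once, i.e. permutations p (cell (i , p i) for row i);
-- 4-simplices are partitions of the grid into five such subsets
-- (Latin squares up to renaming symbols); faces are their subsets.

Perm5 : Set
Perm5 = Σ (Fin 5 → Fin 5) Injective′
  where Injective′ = λ (p : Fin 5 → Fin 5) → Injective _≡_ _≡_ p

IsGridPartition : (Fin 5 → Perm5) → Set
IsGridPartition q =
  (∀ i j → ∃[ a ] proj₁ (q a) i ≡ j) ×
  (∀ a b i → proj₁ (q a) i ≡ proj₁ (q b) i → a ≡ b)

S₅ : Complex
S₅ = record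
  { V    = Perm5
  ; _≈_  = λ p q → ∀ i → proj₁ p i ≡ proj₁ q i
  ; Face = λ σ → ∃[ q ] IsGridPartition q ×
                   All (λ p → ∃[ a ] (∀ i → proj₁ p i ≡ proj₁ (q a) i)) σ
  }

-- B²(X) with 4 colors (the number of colors of the icosahedron, 2+2,
-- is kept when iterating B).
B² : ℕ → Complex → Complex
B² k X = B k (B k X)

module Submission where

-- Every vertex link of S₅,
-- and B²(I) for the icosahedron I, is isomorphic to one explicit complex
-- T₂ (44 vertices, the 56 rows of a table as facets); composing gives the
-- theorem.
-- * Regularity: renaming the columns of the grid is an automorphism of S₅
--   taking the diagonal (identity) to any vertex p, and isomorphisms
--   restrict to links (Link-cong), so Link(S₅, p) ≅ Link(S₅, id).
-- * Link(S₅, id) ≅ T₂: its vertices are the 44 derangements; three pairwise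
--   disjoint ones lie in a facet of T₂ and the fourth row is then forced.
-- * B²(I) ≅ T₂: a complete table of colourings computes B of a finite
--   complex (B-classification); verified exhaustive searches list the 10
--   colourings of I, giving B(I) ≅ T₁, and the 56 colourings of T₁; B
--   respects isomorphisms (B-cong), so B²(I) ≅ B(T₁) ≅ T₂.

open import Defs
open import Data.Product using (_×_)

open import Data.Nat as ℕ using (ℕ; zero; suc; _+_; _∸_; _<_; s≤s)
open import Data.Nat.Properties as ℕP using (+-suc; +-identityʳ; 1+n≰n)
open import Data.Bool as Bool using (Bool; true; T; not; _∨_)
open import Data.Bool.ListAction using (all)
open import Data.Fin as Fin using (Fin; zero; suc; toℕ; fromℕ<; _≟_; punchIn; punchOut)
open import Data.Fin.Properties using
  (all?; any?; toℕ<n; toℕ-fromℕ<; fromℕ<-toℕ; toℕ-injective; injective⇒≤; punchOut-injective;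
   punchIn-punchOut; punchInᵢ≢i; punchIn-injective)
open import Data.Vec using (Vec; []; _∷_; lookup)
open import Data.List.Base as List using (List; []; _∷_; map; allFin; length; upTo)
open import Data.List.Properties using (map-∘; map-id)
open import Data.List.Membership.Propositional using (_∈_; find)
open import Data.List.Membership.Propositional.Properties using (∈-allFin)
open import Data.List.Relation.Unary.All as All using (All; []; _∷_)
open import Data.List.Relation.Unary.All.Properties as AllP using (all⁺; all⁻)
open import Data.List.Relation.Unary.Any as Any using (Any)
open import Data.List.Relation.Binary.Pointwise as Pw using (Pointwise; []; _∷_; Pointwise-≡⇒≡)
open import Data.Maybe using (maybe; just; nothing)
open import Data.Product using (∃-syntax; _,_; proj₁; proj₂)
open import Data.Sum using (_⊎_; inj₁; inj₂; [_,_]′)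
open import Data.Empty using (⊥-elim)
open import Relation.Nullary using (Dec; does; yes; no; contradiction; _×-dec_; _⊎-dec_; _→-dec_; ¬?)
open import Relation.Nullary.Decidable using (True; isYes; toWitness; from-yes; dec-true; dec-false)
open import Relation.Binary.Structures using (IsEquivalence)
open import Relation.Binary.PropositionalEquality as ≡
  using (_≡_; _≢_; refl; sym; trans; cong; cong₂; subst; subst₂)
open import Function using (_∘_)
open import Function.Definitions using (Injective)

-- An injective endomap of Fin n is onto: missing a value j, it would
-- inject Fin n into Fin (n - 1) by punching j out.
injective⇒surjective : ∀ {n} (f : Fin n → Fin n) → Injective _≡_ _≡_ f → ∀ j → ∃[ i ] f i ≡ j
injective⇒surjective {suc n} f f-inj j with any? (λ i → f i ≟ j)
... | yes hit = hit
... | no miss = contradiction (injective⇒≤ squeeze-injective) 1+n≰n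
  where
  squeeze : Fin (suc n) → Fin n
  squeeze i = punchOut {i = j} {j = f i} (λ j≡fi → miss (i , sym j≡fi))
  squeeze-injective : Injective _≡_ _≡_ squeeze
  squeeze-injective {i} {i′} eq =
    f-inj (punchOut-injective (λ j≡fi → miss (i , sym j≡fi)) (λ j≡fi′ → miss (i′ , sym j≡fi′)) eq)

record IsSetoidComplex (X : Complex) : Set where
  field
    isEquivalence : IsEquivalence (_≈_ X)
    face-resp     : ∀ {σ τ} → Pointwise (_≈_ X) σ τ → Face X σ → Face X τ
  open IsEquivalence isEquivalence public

map-pointwise : ∀ {A B : Set} {R : B → B → Set} {f g : A → B} →
                (∀ x → R (f x) (g x)) → ∀ σ → Pointwise R (map f σ) (map g σ)
map-pointwise h []      = []
map-pointwise h (x ∷ σ) = h x ∷ map-pointwise h σ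

-- Inverting an isomorphism only needs the target to be a setoid complex
-- (faces of Y must be moved along  to ∘ from ≈ id).
≅-sym : ∀ {X Y} → IsSetoidComplex Y → X ≅ Y → Y ≅ X
≅-sym {X} {Y} sY α = record
  { to        = from
  ; from      = to
  ; to-cong   = from-cong
  ; from-cong = to-cong
  ; from-to   = to-from
  ; to-from   = from-to
  ; face-to   = λ σ fσ → face-from (map from σ)
                  (Y.face-resp (back σ) fσ)
  ; face-from = λ σ fσ → Y.face-resp (forth σ)
                  (subst (Face Y) (≡.sym (map-∘ σ)) (face-to (map from σ) fσ))
  }
  where
  open _≅_ α
  module Y = IsSetoidComplex sY
  forth : ∀ σ → Pointwise (_≈_ Y) (map (to ∘ from) σ) σ
  forth σ = subst (Pointwise (_≈_ Y) (map (to ∘ from) σ)) (map-id σ) (map-pointwise to-from σ)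
  back : ∀ σ → Pointwise (_≈_ Y) σ (map to (map from σ))
  back σ = subst (Pointwise (_≈_ Y) σ) (map-∘ σ) (Pw.symmetric Y.sym (forth σ))

≅-trans : ∀ {X Y Z} → IsSetoidComplex X → IsSetoidComplex Z → X ≅ Y → Y ≅ Z → X ≅ Z
≅-trans {X} {Y} {Z} sX sZ α β = record
  { to        = β.to ∘ α.to
  ; from      = α.from ∘ β.from
  ; to-cong   = β.to-cong ∘ α.to-cong
  ; from-cong = α.from-cong ∘ β.from-cong
  ; from-to   = λ x → IsSetoidComplex.trans sX (α.from-cong (β.from-to (α.to x))) (α.from-to x)
  ; to-from   = λ z → IsSetoidComplex.trans sZ (β.to-cong (α.to-from (β.from z))) (β.to-from z)
  ; face-to   = λ σ fσ → subst (Face Z) (≡.sym (map-∘ σ)) (β.face-to (map α.to σ) (α.face-to σ fσ))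
  ; face-from = λ σ fσ → α.face-from σ (β.face-from (map α.to σ) (subst (Face Z) (map-∘ σ) fσ))
  }
  where
  module α = _≅_ α
  module β = _≅_ β

Link-cong : ∀ {X Y} → IsSetoidComplex X → IsSetoidComplex Y →
            (α : X ≅ Y) (q : V Y) → Link X (_≅_.from α q) ≅ Link Y q
Link-cong {X} {Y} sX sY α q = record
  { to        = toL
  ; from      = fromL
  ; to-cong   = to-cong
  ; from-cong = from-cong
  ; from-to   = λ x → from-to (proj₁ x)
  ; to-from   = λ y → to-from (proj₁ y)
  ; face-to   = λ σ fσ → Y.face-resp (to-from q ∷ toL-pointwise σ) (face-to (p ∷ map proj₁ σ) fσ)
  ; face-from = λ σ fσ → face-from (p ∷ map proj₁ σ)
                  (Y.face-resp (Y.sym (to-from q) ∷ Pw.symmetric Y.sym (toL-pointwise σ)) fσ)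
  }
  where
  open _≅_ α
  module X = IsSetoidComplex sX
  module Y = IsSetoidComplex sY
  p : V X
  p = from q
  toL : V (Link X p) → V (Link Y q)
  toL (w , w≉p , fw) =
    to w ,
    (λ tw≈q → w≉p (X.trans (X.sym (from-to w)) (from-cong tw≈q))) ,
    Y.face-resp (to-from q ∷ Y.refl ∷ []) (face-to (p ∷ w ∷ []) fw)
  fromL : V (Link Y q) → V (Link X p)
  fromL (y , y≉q , fy) =
    from y ,
    (λ fy≈p → y≉q (Y.trans (Y.sym (to-from y)) (Y.trans (to-cong fy≈p) (to-from q)))) ,
    face-from (p ∷ from y ∷ []) (Y.face-resp (Y.sym (to-from q) ∷ Y.sym (to-from y) ∷ []) fy)
  toL-pointwise : ∀ σ → Pointwise (_≈_ Y) (map to (map proj₁ σ)) (map proj₁ (map toL σ))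
  toL-pointwise σ = subst₂ (Pointwise (_≈_ Y)) (map-∘ σ) (map-∘ σ) (map-pointwise (λ _ → Y.refl) σ)

Link-setoid : ∀ {X} → IsSetoidComplex X → ∀ p → IsSetoidComplex (Link X p)
Link-setoid {X} sX p = record
  { isEquivalence = record { refl = X.refl ; sym = X.sym ; trans = X.trans }
  ; face-resp     = λ σ≈τ → X.face-resp (X.refl ∷ Pw.map⁺ proj₁ proj₁ σ≈τ)
  }
  where module X = IsSetoidComplex sX

IsClassOf-resp : ∀ {k X} (f : Coloring k X) {S S′ : V X → Bool} →
                 (∀ v → S v ≡ S′ v) → IsClassOf {k} {X} f S → IsClassOf {k} {X} f S′
IsClassOf-resp f S≗S′ (c , inhabited , S-def) = c , inhabited , λ v → trans (sym (S≗S′ v)) (S-def v)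

B-setoid : ∀ k X → IsSetoidComplex (B k X)
B-setoid k X = record
  { isEquivalence = record
      { refl  = λ _ → refl
      ; sym   = λ S≗T v → sym (S≗T v)
      ; trans = λ S≗T T≗U v → trans (S≗T v) (T≗U v)
      }
  ; face-resp = λ { σ≈τ (f , classes) → f , resp f σ≈τ classes }
  }
  where
  resp : ∀ f {σ τ} → Pointwise (_≈_ (B k X)) σ τ →
         All (λ S → IsClassOf {k} {X} f (proj₁ S)) σ → All (λ S → IsClassOf {k} {X} f (proj₁ S)) τ
  resp f []            []            = []
  resp f (S≗T ∷ σ≈τ) (cS ∷ classes) = IsClassOf-resp {k} {X} f S≗T cS ∷ resp f σ≈τ classes

pullColoring : ∀ {k X Y} → IsSetoidComplex X → X ≅ Y → Coloring k Y → Coloring k X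
pullColoring {k} {X} {Y} sX α (g , g-cong , g-proper) =
  g ∘ to ,
  (λ u v u≈v → g-cong (to u) (to v) (to-cong u≈v)) ,
  (λ u v fuv u≉v → g-proper (to u) (to v) (face-to (u ∷ v ∷ []) fuv) (λ tu≈tv →
     u≉v (X.trans (X.sym (from-to u)) (X.trans (from-cong tu≈tv) (from-to v)))))
  where
  open _≅_ α
  module X = IsSetoidComplex sX

pullClass : ∀ {k X Y} (sX : IsSetoidComplex X) (α : X ≅ Y) (g : Coloring k Y) {S} →
            IsClassOf {k} {Y} g S → IsClassOf {k} {X} (pullColoring sX α g) (S ∘ _≅_.to α)
pullClass sX α (g , g-cong , _) (c , (y , gy≡c) , S-def) =
  c , (from y , trans (g-cong _ _ (to-from y)) gy≡c) , λ v → S-def (to v)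
  where open _≅_ α

class-resp : ∀ {k X} (f : Coloring k X) {S} → IsClassOf {k} {X} f S →
             ∀ {u v} → _≈_ X u v → S u ≡ S v
class-resp (f , f-cong , _) (c , _ , S-def) {u} {v} u≈v =
  trans (S-def u) (trans (cong (λ a → does (a Fin.≟ c)) (f-cong u v u≈v)) (sym (S-def v)))

B-cong : ∀ {k X Y} → IsSetoidComplex X → IsSetoidComplex Y → X ≅ Y → B k X ≅ B k Y
B-cong {k} {X} {Y} sX sY α = record
  { to        = pullB sY α⁻¹
  ; from      = pullB sX α
  ; to-cong   = λ S≗T y → S≗T (from y)
  ; from-cong = λ S≗T x → S≗T (to x)
  ; from-to   = λ { (S , f , cS) x → class-resp {k} {X} f cS (from-to x) }
  ; to-from   = λ { (S , g , cS) y → class-resp {k} {Y} g cS (to-from y) }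
  ; face-to   = λ σ → λ { (f , classes) →
      pullColoring sY α⁻¹ f , AllP.map⁺ (All.map (pullClass sY α⁻¹ f) classes) }
  ; face-from = λ σ → λ { (g , classes) →
      pullColoring sX α g ,
      All.map (λ {x} cSft → IsClassOf-resp {k} {X} (pullColoring sX α g)
                 (λ v → class-resp {k} {X} (proj₁ (proj₂ x)) (proj₂ (proj₂ x)) (from-to v))
                 (pullClass sX α g cSft))
              (AllP.map⁻ classes) }
  }
  where
  open _≅_ α
  α⁻¹ : Y ≅ X
  α⁻¹ = ≅-sym sY α
  pullB : ∀ {X Y} → IsSetoidComplex X → X ≅ Y → V (B k Y) → V (B k X)
  pullB sX β (S , g , cS) = S ∘ _≅_.to β , pullColoring sX β g , pullClass sX β g cS

FiniteComplex : (n : ℕ) → (List (Fin n) → Set) → Complex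
FiniteComplex n F = record { V = Fin n ; _≈_ = _≡_ ; Face = F }

finite-setoid : ∀ {n} (F : List (Fin n) → Set) → IsSetoidComplex (FiniteComplex n F)
finite-setoid F = record
  { isEquivalence = ≡.isEquivalence
  ; face-resp     = λ σ≡τ → subst F (Pointwise-≡⇒≡ σ≡τ)
  }

RowFace : ∀ {n m d} → (Fin m → Fin d → Fin n) → List (Fin n) → Set
RowFace row σ = ∃[ t ] All (λ v → ∃[ a ] v ≡ row t a) σ

TableComplex : ∀ {n m d} → (Fin m → Fin d → Fin n) → Complex
TableComplex {n} row = FiniteComplex n (RowFace row)

IsRenaming : ∀ {A : Set} {k} → (A → Fin k) → (A → Fin k) → Set
IsRenaming {k = k} f g = ∃[ ρ ] Injective _≡_ _≡_ ρ × (∀ v → f v ≡ ρ (g v))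

does-injective : ∀ {k} {ρ : Fin k → Fin k} → Injective _≡_ _≡_ ρ →
                 ∀ a b → does (ρ a Fin.≟ ρ b) ≡ does (a Fin.≟ b)
does-injective {ρ = ρ} ρ-inj a b with a Fin.≟ b
... | yes refl = dec-true (ρ a Fin.≟ ρ a) refl
... | no  a≢b  = dec-false (ρ a Fin.≟ ρ b) (a≢b ∘ ρ-inj)

renaming-class : ∀ {k X} (f : Coloring k X) {g : V X → Fin k} → IsRenaming (proj₁ f) g →
                 ∀ {S} → IsClassOf {k} {X} f S → ∃[ a ] (∀ v → S v ≡ does (g v Fin.≟ a))
renaming-class f {g} (ρ , ρ-inj , f≗ρg) {S} (c , (v₀ , fv₀≡c) , S-def) =
  g v₀ , λ v → begin
    S v                                  ≡⟨ S-def v ⟩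
    does (proj₁ f v Fin.≟ c)             ≡⟨ cong₂ (λ x y → does (x Fin.≟ y)) (f≗ρg v) (trans (sym fv₀≡c) (f≗ρg v₀)) ⟩
    does (ρ (g v) Fin.≟ ρ (g v₀))        ≡⟨ does-injective ρ-inj (g v) (g v₀) ⟩
    does (g v Fin.≟ g v₀)                ∎
  where open ≡.≡-Reasoning

record ColouringTable (k n : ℕ) (F : List (Fin n) → Set) : Set where
  X : Complex
  X = FiniteComplex n F
  field
    {m c}            : ℕ
    colouring        : Fin m → Coloring k X
    class            : Fin c → Fin n → Bool
    classOf          : Fin m → Fin k → Fin c
    classOf-class    : ∀ t a v → class (classOf t a) v ≡ does (proj₁ (colouring t) v Fin.≟ a)
    all-colours-used : ∀ t a → ∃[ v ] proj₁ (colouring t) v ≡ a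
    classOf-onto     : ∀ i → ∃[ t ] ∃[ a ] classOf t a ≡ i
    class-injective  : ∀ i j → (∀ v → class i v ≡ class j v) → i ≡ j
    complete         : (f : Coloring k X) → ∃[ t ] IsRenaming (proj₁ f) (proj₁ (colouring t))

  classOf-isClass : ∀ t a → IsClassOf {k} {X} (colouring t) (class (classOf t a))
  classOf-isClass t a = a , all-colours-used t a , classOf-class t a

  classify : (f : Coloring k X) {S : Fin n → Bool} → IsClassOf {k} {X} f S →
             ∃[ a ] (∀ v → class (classOf (proj₁ (complete f)) a) v ≡ S v)
  classify f cS = let (a , S≗) = renaming-class {k} {X} f (proj₂ (complete f)) cS
                  in a , λ v → trans (classOf-class _ a v) (sym (S≗ v))

B-classification : ∀ {k n F} (T : ColouringTable k n F) →
                   B k (FiniteComplex n F) ≅ TableComplex (ColouringTable.classOf T)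
B-classification {k} {n} {F} T = record
  { to        = index
  ; from      = representative
  ; to-cong   = λ {x} {y} x≗y → class-injective _ _ (λ v →
                  trans (index-correct x v) (trans (x≗y v) (sym (index-correct y v))))
  ; from-cong = λ { refl v → refl }
  ; from-to   = index-correct
  ; to-from   = λ i → class-injective _ _ (index-correct (representative i))
  ; face-to   = λ σ → λ { (f , classes) →
      proj₁ (complete f) , AllP.map⁺ (All.map (λ {x} → index-row f x) classes) }
  ; face-from = λ σ → λ { (t , rows) →
      colouring t , All.map (λ {x} → λ { (a , x↦a) → IsClassOf-resp {k} {X} (colouring t)
          (λ v → trans (cong (λ i → class i v) (sym x↦a)) (index-correct x v))
          (classOf-isClass t a) }) (AllP.map⁻ rows) }
  }
  where
  open ColouringTable T
  index : V (B k X) → Fin c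
  index (S , f , cS) = classOf (proj₁ (complete f)) (proj₁ (classify f cS))
  index-correct : ∀ x v → class (index x) v ≡ proj₁ x v
  index-correct (S , f , cS) = proj₂ (classify f cS)
  index-row : ∀ f x → IsClassOf {k} {X} f (proj₁ x) → ∃[ a ] index x ≡ classOf (proj₁ (complete f)) a
  index-row f x cx = proj₁ (classify f cx) ,
    class-injective _ _ (λ v → trans (index-correct x v) (sym (proj₂ (classify f cx) v)))
  representative : Fin c → V (B k X)
  representative i = class i , colouring t ,
    subst (λ j → IsClassOf {k} {X} (colouring t) (class j)) t,a↦i (classOf-isClass t a)
    where
    t : Fin m
    t = proj₁ (classOf-onto i)
    a : Fin k
    a = proj₁ (proj₂ (classOf-onto i))
    t,a↦i : classOf t a ≡ i
    t,a↦i = proj₂ (proj₂ (classOf-onto i))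

S₅-setoid : IsSetoidComplex S₅
S₅-setoid = record
  { isEquivalence = record
      { refl  = λ _ → refl
      ; sym   = λ p≈q i → sym (p≈q i)
      ; trans = λ p≈q q≈r i → trans (p≈q i) (q≈r i)
      }
  ; face-resp = λ { σ≈τ (q , partition , members) → q , partition , resp {q} σ≈τ members }
  }
  where
  resp : ∀ {q σ τ} → Pointwise (_≈_ S₅) σ τ →
         All (λ p → ∃[ a ] (∀ i → proj₁ p i ≡ proj₁ (q a) i)) σ →
         All (λ p → ∃[ a ] (∀ i → proj₁ p i ≡ proj₁ (q a) i)) τ
  resp []            []                 = []
  resp {q} (p≈p′ ∷ σ≈τ) ((a , p≈qa) ∷ rest) =
    (a , λ i → trans (sym (p≈p′ i)) (p≈qa i)) ∷ resp {q} σ≈τ rest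

relabel : (π : Fin 5 → Fin 5) → Injective _≡_ _≡_ π → Perm5 → Perm5
relabel π π-inj (w , w-inj) = π ∘ w , w-inj ∘ π-inj

relabel-face : (π : Fin 5 → Fin 5) (π-inj : Injective _≡_ _≡_ π) → (∀ j → ∃[ i ] π i ≡ j) →
               ∀ σ → Face S₅ σ → Face S₅ (map (relabel π π-inj) σ)
relabel-face π π-inj π-onto σ (q , (covers , disjoint) , members) =
  relabel π π-inj ∘ q ,
  ((λ i j → let (a , qai≡k) = covers i (proj₁ (π-onto j))
            in a , trans (cong π qai≡k) (proj₂ (π-onto j))) ,
   (λ a b i πqai≡πqbi → disjoint a b i (π-inj πqai≡πqbi))) ,
  AllP.map⁺ (All.map (λ { (a , p≈qa) → a , λ i → cong π (p≈qa i) }) members)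

-- Every column renaming is an automorphism of S₅; the one given by p
-- moves the identity permutation to p.
columnRelabel : (p : Perm5) → S₅ ≅ S₅
columnRelabel (π , π-inj) = record
  { to        = relabel π⁻¹ π⁻¹-inj
  ; from      = relabel π π-inj
  ; to-cong   = λ p≈q i → cong π⁻¹ (p≈q i)
  ; from-cong = λ p≈q i → cong π (p≈q i)
  ; from-to   = λ w i → π∘π⁻¹ (proj₁ w i)
  ; to-from   = λ w i → π⁻¹∘π (proj₁ w i)
  ; face-to   = relabel-face π⁻¹ π⁻¹-inj (λ j → π j , π⁻¹∘π j)
  ; face-from = λ σ fσ → IsSetoidComplex.face-resp S₅-setoid (round-trip σ)
      (subst (Face S₅) (sym (map-∘ σ))
        (relabel-face π π-inj (λ j → π⁻¹ j , π∘π⁻¹ j) (map (relabel π⁻¹ π⁻¹-inj) σ) fσ))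
  }
  where
  π⁻¹ : Fin 5 → Fin 5
  π⁻¹ j = proj₁ (injective⇒surjective π π-inj j)
  π∘π⁻¹ : ∀ j → π (π⁻¹ j) ≡ j
  π∘π⁻¹ j = proj₂ (injective⇒surjective π π-inj j)
  π⁻¹∘π : ∀ i → π⁻¹ (π i) ≡ i
  π⁻¹∘π i = π-inj (π∘π⁻¹ (π i))
  π⁻¹-inj : Injective _≡_ _≡_ π⁻¹
  π⁻¹-inj {j} {j′} eq = trans (sym (π∘π⁻¹ j)) (trans (cong π eq) (π∘π⁻¹ j′))
  round-trip : ∀ σ → Pointwise (_≈_ S₅) (map (relabel π π-inj ∘ relabel π⁻¹ π⁻¹-inj) σ) σ
  round-trip []      = []
  round-trip (w ∷ σ) = (λ i → π∘π⁻¹ (proj₁ w i)) ∷ round-trip σ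

idP : Perm5
idP = (λ i → i) , λ eq → eq

link-to-identity : (p : Perm5) → Link S₅ p ≅ Link S₅ idP
link-to-identity p = Link-cong S₅-setoid S₅-setoid (columnRelabel p) idP

-- Exhaustive search through the colourings of a graph on the vertices
-- 0, …, n - 1.  Vertices are coloured in increasing order, and a colour
-- is only tried at vertex m if it differs from the colours of the
-- already coloured neighbours listed in  earlier m.
module ColouringSearch {k n : ℕ} (earlier : ℕ → List ℕ)
                       (Q : (Fin n → Fin (suc k)) → Set) (Q? : ∀ f → Dec (Q f))
                       (Q-resp : ∀ {f g} → (∀ v → f v ≡ g v) → Q f → Q g) where

  Colour : Set
  Colour = Fin (suc k)

  -- A partial colouring of the vertices 0, …, m - 1, latest vertex first.
  Partial : Set
  Partial = List Colour

  nth : Partial → ℕ → Colour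
  nth []       _       = zero
  nth (c ∷ cs) zero    = c
  nth (c ∷ cs) (suc d) = nth cs d

  colourOf : Partial → ℕ → Colour
  colourOf cs j = nth cs (length cs ∸ suc j)

  admissible : ℕ → Partial → Colour → Bool
  admissible m cs a = all (λ j → not (does (colourOf cs j ≟ a))) (earlier m)

  T-≢ : ∀ {x y : Colour} → x ≢ y → T (not (does (x ≟ y)))
  T-≢ {x} {y} x≢y with x ≟ y
  ... | yes x≡y = x≢y x≡y
  ... | no  _   = _

  search : (r m : ℕ) → Partial → Bool
  search zero    m cs = isYes (Q? (colourOf cs ∘ toℕ))
  search (suc r) m cs = all (λ a → not (admissible m cs a) ∨ search r (suc m) (a ∷ cs)) (allFin (suc k))

  module Along (g : ℕ → Colour) where
    prefix : ℕ → Partial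
    prefix zero    = []
    prefix (suc m) = g m ∷ prefix m

    length-prefix : ∀ m → length (prefix m) ≡ m
    length-prefix zero    = refl
    length-prefix (suc m) = cong suc (length-prefix m)

    nth-prefix : ∀ m d → d < m → nth (prefix m) d ≡ g (m ∸ suc d)
    nth-prefix (suc m) zero    _         = refl
    nth-prefix (suc m) (suc d) (s≤s d<m) = nth-prefix m d d<m

    colourOf-prefix : ∀ m j → j < m → colourOf (prefix m) j ≡ g j
    colourOf-prefix (suc m) j (s≤s j≤m) =
      trans (cong (λ l → nth (prefix (suc m)) (l ∸ suc j)) (length-prefix (suc m)))
        (trans (nth-prefix (suc m) (m ∸ j) (s≤s (ℕP.m∸n≤m m j))) (cong g (ℕP.m∸[m∸n]≡n j≤m)))

    -- Following g through the search tree: if g is admissible at every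
    -- step, the search reaches the leaf g and there Q was checked.
    sound : ∀ r m → (∀ m′ → m′ < r + m → T (admissible m′ (prefix m′) (g m′))) →
            T (search r m (prefix m)) → Q (colourOf (prefix (r + m)) ∘ toℕ)
    sound zero    m _   found = toWitness found
    sound (suc r) m adm found =
      subst (λ l → Q (colourOf (prefix l) ∘ toℕ)) (+-suc r m)
        (sound r (suc m) (λ m′ lt → adm m′ (subst (m′ <_) (+-suc r m) lt))
          (take-branch (adm m (s≤s (ℕP.m≤n+m m r)))
            (All.lookup (all⁺ _ (allFin (suc k)) found) (∈-allFin (g m)))))
      where
      take-branch : ∀ {b x} → T b → T (not b ∨ x) → T x
      take-branch {true} _ x = x

  -- Vertices are coloured from Fin n; outside the range a default colour.
  extend : (Fin n → Colour) → ℕ → Colour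
  extend f m with m ℕ.<? n
  ... | yes m<n = f (fromℕ< m<n)
  ... | no  _   = zero

  extend-fromℕ< : ∀ f {m} (m<n : m < n) → extend f m ≡ f (fromℕ< m<n)
  extend-fromℕ< f {m} m<n with m ℕ.<? n
  ... | yes m<n′ = cong f (toℕ-injective (trans (toℕ-fromℕ< m<n′) (sym (toℕ-fromℕ< m<n))))
  ... | no  m≮n  = contradiction m<n m≮n

  extend-toℕ : ∀ f i → extend f (toℕ i) ≡ f i
  extend-toℕ f i = trans (extend-fromℕ< f (toℕ<n i)) (cong f (fromℕ<-toℕ i (toℕ<n i)))

  Ordered : Set
  Ordered = ∀ (i : Fin n) → All (_< toℕ i) (earlier (toℕ i))

  search-sound-from : ∀ r m → r + m ≡ n → Ordered → ∀ f →
                      (∀ i j → toℕ j ∈ earlier (toℕ i) → f j ≢ f i) →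
                      T (search r m (Along.prefix (extend f) m)) → Q f
  search-sound-from r m r+m≡n ordered f proper found =
    Q-resp (λ i → trans (colourOf-prefix n (toℕ i) (toℕ<n i)) (extend-toℕ f i))
      (subst (λ l → Q (colourOf (prefix l) ∘ toℕ)) r+m≡n (sound r m admissible-everywhere found))
    where
    open Along (extend f)
    admissible-everywhere : ∀ m′ → m′ < r + m → T (admissible m′ (prefix m′) (extend f m′))
    admissible-everywhere m′ m′<r+m = all⁻ _ (All.tabulate (λ {j} → differ j))
      where
      m′<n : m′ < n
      m′<n = subst (m′ <_) r+m≡n m′<r+m
      i : Fin n
      i = fromℕ< m′<n
      toℕ-i : toℕ i ≡ m′
      toℕ-i = toℕ-fromℕ< m′<n
      differ : ∀ j → j ∈ earlier m′ → T (not (does (colourOf (prefix m′) j ≟ extend f m′)))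
      differ j j∈ = T-≢ (λ same →
        proper i j′ (subst₂ (λ a b → a ∈ earlier b) (sym (toℕ-fromℕ< j<n)) (sym toℕ-i) j∈)
          (trans (sym (extend-fromℕ< f j<n))
            (trans (sym (colourOf-prefix m′ j j<m′)) (trans same (extend-fromℕ< f m′<n)))))
        where
        j<m′ : j < m′
        j<m′ = subst (j <_) toℕ-i (All.lookup (ordered i) (subst (λ l → j ∈ earlier l) (sym toℕ-i) j∈))
        j<n : j < n
        j<n = ℕP.<-trans j<m′ m′<n
        j′ : Fin n
        j′ = fromℕ< j<n

  search-sound : Ordered → T (search n 0 []) → ∀ f →
                 (∀ i j → toℕ j ∈ earlier (toℕ i) → f j ≢ f i) → Q f
  search-sound ordered found f proper = search-sound-from n 0 (+-identityʳ n) ordered f proper found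

  Spanning : (List (Fin n) → Set) → Set
  Spanning F = ∀ i j → toℕ j ∈ earlier (toℕ i) → F (j ∷ i ∷ []) × j ≢ i

  colouring-sound : ∀ {F} → Ordered → Spanning F → T (search n 0 []) →
                    (f : Coloring (suc k) (FiniteComplex n F)) → Q (proj₁ f)
  colouring-sound ordered spanning found (f , _ , proper) =
    search-sound ordered found f (λ i j j∈ → let (edge , j≢i) = spanning i j j∈ in proper j i edge j≢i)

entry : ∀ {n} → ℕ → Fin (suc n)
entry zero                = zero
entry {zero}  (suc _)     = zero
entry {suc n} (suc m)     = suc (entry m)

-- A table of 4-colourings of a complex on Fin n: the colourings
-- colour t, the index  classOf t a  of the class of colour a in colouring
-- t, and for each class index i a colouring and a colour having class i.
module Tabulated {n m c : ℕ} (colour : Fin m → Fin n → Fin 4) (classOf : Fin m → Fin 4 → Fin c)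
                 (classColouring : Fin c → Fin m) (classColour : Fin c → Fin 4) where

  class : Fin c → Fin n → Bool
  class i v = does (colour (classColouring i) v ≟ classColour i)

  -- the colour renaming that would turn colouring t into f, read off
  -- at one vertex of each colour
  renamer : (Fin n → Fin 4) → Fin m → Fin 4 → Fin 4
  renamer f t a = maybe f zero (List.find (λ v → colour t v ≟ a) (allFin n))

  Listed : (Fin n → Fin 4) → Set
  Listed f = ∃[ t ] (∀ v → f v ≡ renamer f t (colour t v)) ×
                    (∀ a b → renamer f t a ≡ renamer f t b → a ≡ b)

  listed? : ∀ f → Dec (Listed f)
  listed? f = any? λ t → (all? λ v → f v ≟ renamer f t (colour t v))
                         ×-dec (all? λ a → all? λ b → (renamer f t a ≟ renamer f t b) →-dec (a ≟ b))

  listed-resp : ∀ {f g} → (∀ v → f v ≡ g v) → Listed f → Listed g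
  listed-resp {f} {g} f≗g (t , f≗ , inj) =
    t , (λ v → trans (sym (f≗g v)) (trans (f≗ v) (same (colour t v)))) ,
    (λ a b ρa≡ρb → inj a b (trans (same a) (trans ρa≡ρb (sym (same b)))))
    where
    same : ∀ a → renamer f t a ≡ renamer g t a
    same a with List.find (λ v → colour t v ≟ a) (allFin n)
    ... | just v  = f≗g v
    ... | nothing = refl

  listed⇒renaming : ∀ {f} → Listed f → ∃[ t ] IsRenaming f (colour t)
  listed⇒renaming {f} (t , f≗ , inj) = t , renamer f t , (λ {a} {b} → inj a b) , f≗

  Matches : (Fin n → Fin 4) → Set
  Matches f = ∃[ t ] ∀ v → f v ≡ colour t v

  matches? : ∀ f → Dec (Matches f)
  matches? f = any? λ t → all? λ v → f v ≟ colour t v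

  matches-resp : ∀ {f g} → (∀ v → f v ≡ g v) → Matches f → Matches g
  matches-resp f≗g (t , f≗) = t , λ v → trans (sym (f≗g v)) (f≗ v)

  classOf-class? : Dec (∀ t a v → class (classOf t a) v ≡ does (colour t v ≟ a))
  classOf-class? = all? λ t → all? λ a → all? λ v → class (classOf t a) v Bool.≟ does (colour t v ≟ a)

  colours-used? : Dec (∀ t a → ∃[ v ] colour t v ≡ a)
  colours-used? = all? λ t → all? λ a → any? λ v → colour t v ≟ a

  classOf-onto? : Dec (∀ i → classOf (classColouring i) (classColour i) ≡ i)
  classOf-onto? = all? λ i → classOf (classColouring i) (classColour i) ≟ i

  class-injective? : Dec (∀ i j → (∀ v → class i v ≡ class j v) → i ≡ j)
  class-injective? = all? λ i → all? λ j → (all? λ v → class i v Bool.≟ class j v) →-dec (i ≟ j)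

  table : ∀ {F} → (proper : ∀ t u v → F (u ∷ v ∷ []) → u ≢ v → colour t u ≢ colour t v) →
          ((f : Coloring 4 (FiniteComplex n F)) → ∃[ t ] IsRenaming (proj₁ f) (colour t)) →
          {_ : True classOf-class?} {_ : True colours-used?} {_ : True classOf-onto?}
          {_ : True class-injective?} → ColouringTable 4 n F
  table proper complete {ok₁} {ok₂} {ok₃} {ok₄} = record
    { colouring        = λ t → colour t , (λ { u v refl → refl }) , proper t
    ; class            = class
    ; classOf          = classOf
    ; classOf-class    = toWitness ok₁
    ; all-colours-used = toWitness ok₂
    ; classOf-onto     = λ i → classColouring i , classColour i , toWitness ok₃ i
    ; class-injective  = toWitness ok₄
    ; complete         = complete
    }

-- The ten 4-colourings of the icosahedron (up to renaming colours).
colours₁ : Vec (Vec ℕ 12) 10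
colours₁ =
    (0 ∷ 1 ∷ 2 ∷ 1 ∷ 2 ∷ 3 ∷ 3 ∷ 0 ∷ 3 ∷ 0 ∷ 2 ∷ 1 ∷ [])
  ∷ (0 ∷ 1 ∷ 2 ∷ 1 ∷ 2 ∷ 3 ∷ 3 ∷ 0 ∷ 3 ∷ 1 ∷ 0 ∷ 2 ∷ [])
  ∷ (0 ∷ 1 ∷ 2 ∷ 1 ∷ 3 ∷ 2 ∷ 0 ∷ 3 ∷ 0 ∷ 1 ∷ 3 ∷ 2 ∷ [])
  ∷ (0 ∷ 1 ∷ 2 ∷ 1 ∷ 3 ∷ 2 ∷ 0 ∷ 3 ∷ 2 ∷ 0 ∷ 3 ∷ 1 ∷ [])
  ∷ (0 ∷ 1 ∷ 2 ∷ 3 ∷ 1 ∷ 2 ∷ 3 ∷ 0 ∷ 2 ∷ 3 ∷ 0 ∷ 1 ∷ [])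
  ∷ (0 ∷ 1 ∷ 2 ∷ 3 ∷ 1 ∷ 2 ∷ 3 ∷ 1 ∷ 0 ∷ 3 ∷ 0 ∷ 2 ∷ [])
  ∷ (0 ∷ 1 ∷ 2 ∷ 3 ∷ 1 ∷ 3 ∷ 0 ∷ 1 ∷ 2 ∷ 0 ∷ 2 ∷ 3 ∷ [])
  ∷ (0 ∷ 1 ∷ 2 ∷ 3 ∷ 1 ∷ 3 ∷ 3 ∷ 0 ∷ 2 ∷ 0 ∷ 2 ∷ 1 ∷ [])
  ∷ (0 ∷ 1 ∷ 2 ∷ 3 ∷ 2 ∷ 3 ∷ 0 ∷ 1 ∷ 0 ∷ 1 ∷ 2 ∷ 3 ∷ [])
  ∷ (0 ∷ 1 ∷ 2 ∷ 3 ∷ 2 ∷ 3 ∷ 3 ∷ 1 ∷ 0 ∷ 1 ∷ 0 ∷ 2 ∷ [])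
  ∷ []

-- Their twenty colour classes: row t lists the classes of colours 0-3 of colouring t.
classes₁ : Vec (Vec ℕ 4) 10
classes₁ =
    (0 ∷ 1 ∷ 2 ∷ 3 ∷ [])
  ∷ (4 ∷ 5 ∷ 6 ∷ 3 ∷ [])
  ∷ (7 ∷ 5 ∷ 8 ∷ 9 ∷ [])
  ∷ (10 ∷ 1 ∷ 11 ∷ 9 ∷ [])
  ∷ (4 ∷ 12 ∷ 11 ∷ 13 ∷ [])
  ∷ (14 ∷ 15 ∷ 8 ∷ 13 ∷ [])
  ∷ (10 ∷ 15 ∷ 16 ∷ 17 ∷ [])
  ∷ (0 ∷ 12 ∷ 16 ∷ 18 ∷ [])
  ∷ (7 ∷ 19 ∷ 2 ∷ 17 ∷ [])
  ∷ (14 ∷ 19 ∷ 6 ∷ 18 ∷ [])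
  ∷ []

classColouring₁ : Vec ℕ 20
classColouring₁ = 0 ∷ 0 ∷ 0 ∷ 0 ∷ 1 ∷ 1 ∷ 1 ∷ 2 ∷ 2 ∷ 2 ∷ 3 ∷ 3 ∷ 4 ∷ 4 ∷ 5 ∷ 5 ∷ 6 ∷ 6 ∷ 7 ∷ 8 ∷ []

classColour₁ : Vec ℕ 20
classColour₁ = 0 ∷ 1 ∷ 2 ∷ 3 ∷ 0 ∷ 1 ∷ 2 ∷ 0 ∷ 2 ∷ 3 ∷ 0 ∷ 2 ∷ 1 ∷ 3 ∷ 0 ∷ 1 ∷ 2 ∷ 3 ∷ 3 ∷ 1 ∷ []

earlier₁ : ℕ → List ℕ
earlier₁ 0 = []
earlier₁ 1 = 0 ∷ []
earlier₁ 2 = 0 ∷ 1 ∷ []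
earlier₁ 3 = 0 ∷ 2 ∷ []
earlier₁ 4 = 0 ∷ 3 ∷ []
earlier₁ 5 = 0 ∷ 1 ∷ 4 ∷ []
earlier₁ 6 = 1 ∷ 2 ∷ []
earlier₁ 7 = 2 ∷ 3 ∷ 6 ∷ []
earlier₁ 8 = 3 ∷ 4 ∷ 7 ∷ []
earlier₁ 9 = 4 ∷ 5 ∷ 8 ∷ []
earlier₁ 10 = 1 ∷ 5 ∷ 6 ∷ 9 ∷ []
earlier₁ 11 = 6 ∷ 7 ∷ 8 ∷ 9 ∷ 10 ∷ []
earlier₁ _ = []

colour₁ : Fin 10 → Fin 12 → Fin 4
colour₁ t v = entry (lookup (lookup colours₁ t) v)

classOf₁ : Fin 10 → Fin 4 → Fin 20
classOf₁ t a = entry (lookup (lookup classes₁ t) a)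

T₁ : Complex
T₁ = TableComplex classOf₁

module Tab₁ = Tabulated colour₁ classOf₁
                        (λ i → entry (lookup classColouring₁ i)) (λ i → entry (lookup classColour₁ i))

opaque
  triangles-proper₁ : ∀ t → All (λ tri → All (λ u → All (λ v → u ≡ v ⊎ colour₁ t u ≢ colour₁ t v) tri) tri)
                                icosaTriangles
  triangles-proper₁ = from-yes (all? λ t → All.all? (λ tri → All.all? (λ u → All.all? (λ v →
    (u ≟ v) ⊎-dec ¬? (colour₁ t u ≟ colour₁ t v)) tri) tri) icosaTriangles)

module Search₁ = ColouringSearch {3} {12} earlier₁ Tab₁.Listed Tab₁.listed? Tab₁.listed-resp

opaque
  earlier₁-ordered : Search₁.Ordered
  earlier₁-ordered = from-yes (all? λ (i : Fin 12) → All.all? (λ j → j ℕ.<? toℕ i) (earlier₁ (toℕ i)))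

opaque
  earlier₁-adjacent : ∀ (i j : Fin 12) → toℕ j ∈ earlier₁ (toℕ i) →
                      Any (λ tri → j ∈ tri × i ∈ tri) icosaTriangles × j ≢ i
  earlier₁-adjacent = from-yes (all? λ (i : Fin 12) → all? λ (j : Fin 12) →
     Any.any? (toℕ j ℕ.≟_) (earlier₁ (toℕ i)) →-dec
     (Any.any? (λ tri → Any.any? (j ≟_) tri ×-dec Any.any? (i ≟_) tri) icosaTriangles ×-dec ¬? (j ≟ i)))

earlier₁-spanning : Search₁.Spanning (Face Icosahedron)
earlier₁-spanning i j j∈ =
  let (tri , tri∈ , j∈tri , i∈tri) = find (proj₁ (earlier₁-adjacent i j j∈))
  in (tri , tri∈ , j∈tri ∷ i∈tri ∷ []) , proj₂ (earlier₁-adjacent i j j∈)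

complete₁ : (f : Coloring 4 Icosahedron) → Tab₁.Listed (proj₁ f)
complete₁ = Search₁.colouring-sound {Face Icosahedron} earlier₁-ordered earlier₁-spanning _

table₁ : ColouringTable 4 12 (Face Icosahedron)
table₁ = Tab₁.table {Face Icosahedron} (λ t u v → λ { (tri , tri∈ , u∈ ∷ v∈ ∷ []) u≢v →
    [ (λ u≡v → ⊥-elim (u≢v u≡v)) , (λ differ → differ) ]′
      (All.lookup (All.lookup (All.lookup (triangles-proper₁ t) tri∈) u∈) v∈) })
  (Tab₁.listed⇒renaming ∘ complete₁)

B-icosahedron : B 4 Icosahedron ≅ T₁
B-icosahedron = B-classification table₁

-- The 56 colourings of T₁ (up to renaming colours), normalised to colour
-- the vertices 0, 1, 2, 3 of the first facet by 0, 1, 2, 3.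
colours₂ : Vec (Vec ℕ 20) 56
colours₂ =
    (0 ∷ 1 ∷ 2 ∷ 3 ∷ 0 ∷ 1 ∷ 2 ∷ 0 ∷ 2 ∷ 3 ∷ 0 ∷ 2 ∷ 1 ∷ 3 ∷ 0 ∷ 1 ∷ 2 ∷ 3 ∷ 3 ∷ 1 ∷ [])
  ∷ (0 ∷ 1 ∷ 2 ∷ 3 ∷ 0 ∷ 1 ∷ 2 ∷ 0 ∷ 2 ∷ 3 ∷ 0 ∷ 2 ∷ 3 ∷ 1 ∷ 0 ∷ 3 ∷ 2 ∷ 1 ∷ 1 ∷ 3 ∷ [])
  ∷ (0 ∷ 1 ∷ 2 ∷ 3 ∷ 0 ∷ 1 ∷ 2 ∷ 0 ∷ 3 ∷ 2 ∷ 0 ∷ 3 ∷ 1 ∷ 2 ∷ 0 ∷ 1 ∷ 2 ∷ 3 ∷ 3 ∷ 1 ∷ [])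
  ∷ (0 ∷ 1 ∷ 2 ∷ 3 ∷ 0 ∷ 1 ∷ 2 ∷ 0 ∷ 3 ∷ 2 ∷ 0 ∷ 3 ∷ 2 ∷ 1 ∷ 0 ∷ 2 ∷ 1 ∷ 3 ∷ 3 ∷ 1 ∷ [])
  ∷ (0 ∷ 1 ∷ 2 ∷ 3 ∷ 0 ∷ 1 ∷ 2 ∷ 0 ∷ 3 ∷ 2 ∷ 0 ∷ 3 ∷ 2 ∷ 1 ∷ 0 ∷ 2 ∷ 3 ∷ 1 ∷ 1 ∷ 3 ∷ [])
  ∷ (0 ∷ 1 ∷ 2 ∷ 3 ∷ 0 ∷ 1 ∷ 2 ∷ 3 ∷ 0 ∷ 2 ∷ 0 ∷ 3 ∷ 1 ∷ 2 ∷ 1 ∷ 3 ∷ 2 ∷ 1 ∷ 3 ∷ 0 ∷ [])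
  ∷ (0 ∷ 1 ∷ 2 ∷ 3 ∷ 0 ∷ 1 ∷ 2 ∷ 3 ∷ 0 ∷ 2 ∷ 0 ∷ 3 ∷ 2 ∷ 1 ∷ 3 ∷ 2 ∷ 3 ∷ 1 ∷ 1 ∷ 0 ∷ [])
  ∷ (0 ∷ 1 ∷ 2 ∷ 3 ∷ 0 ∷ 1 ∷ 2 ∷ 3 ∷ 2 ∷ 0 ∷ 2 ∷ 3 ∷ 2 ∷ 1 ∷ 0 ∷ 3 ∷ 1 ∷ 0 ∷ 3 ∷ 1 ∷ [])
  ∷ (0 ∷ 1 ∷ 2 ∷ 3 ∷ 0 ∷ 1 ∷ 2 ∷ 3 ∷ 2 ∷ 0 ∷ 2 ∷ 3 ∷ 2 ∷ 1 ∷ 3 ∷ 0 ∷ 3 ∷ 1 ∷ 1 ∷ 0 ∷ [])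
  ∷ (0 ∷ 1 ∷ 2 ∷ 3 ∷ 0 ∷ 1 ∷ 2 ∷ 3 ∷ 2 ∷ 0 ∷ 3 ∷ 2 ∷ 1 ∷ 3 ∷ 0 ∷ 1 ∷ 2 ∷ 0 ∷ 3 ∷ 1 ∷ [])
  ∷ (0 ∷ 1 ∷ 2 ∷ 3 ∷ 0 ∷ 1 ∷ 2 ∷ 3 ∷ 2 ∷ 0 ∷ 3 ∷ 2 ∷ 1 ∷ 3 ∷ 1 ∷ 0 ∷ 2 ∷ 1 ∷ 3 ∷ 0 ∷ [])
  ∷ (0 ∷ 1 ∷ 2 ∷ 3 ∷ 0 ∷ 1 ∷ 2 ∷ 3 ∷ 2 ∷ 0 ∷ 3 ∷ 2 ∷ 3 ∷ 1 ∷ 3 ∷ 0 ∷ 2 ∷ 1 ∷ 1 ∷ 0 ∷ [])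
  ∷ (0 ∷ 1 ∷ 2 ∷ 3 ∷ 0 ∷ 2 ∷ 1 ∷ 0 ∷ 1 ∷ 3 ∷ 0 ∷ 2 ∷ 1 ∷ 3 ∷ 0 ∷ 2 ∷ 3 ∷ 1 ∷ 2 ∷ 3 ∷ [])
  ∷ (0 ∷ 1 ∷ 2 ∷ 3 ∷ 0 ∷ 2 ∷ 1 ∷ 1 ∷ 0 ∷ 3 ∷ 0 ∷ 2 ∷ 1 ∷ 3 ∷ 2 ∷ 1 ∷ 2 ∷ 3 ∷ 3 ∷ 0 ∷ [])
  ∷ (0 ∷ 1 ∷ 2 ∷ 3 ∷ 0 ∷ 2 ∷ 1 ∷ 1 ∷ 0 ∷ 3 ∷ 0 ∷ 2 ∷ 3 ∷ 1 ∷ 3 ∷ 2 ∷ 1 ∷ 3 ∷ 2 ∷ 0 ∷ [])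
  ∷ (0 ∷ 1 ∷ 2 ∷ 3 ∷ 0 ∷ 2 ∷ 1 ∷ 1 ∷ 3 ∷ 0 ∷ 2 ∷ 3 ∷ 1 ∷ 2 ∷ 0 ∷ 1 ∷ 3 ∷ 0 ∷ 2 ∷ 3 ∷ [])
  ∷ (0 ∷ 1 ∷ 2 ∷ 3 ∷ 0 ∷ 2 ∷ 1 ∷ 1 ∷ 3 ∷ 0 ∷ 2 ∷ 3 ∷ 2 ∷ 1 ∷ 2 ∷ 0 ∷ 1 ∷ 3 ∷ 3 ∷ 0 ∷ [])
  ∷ (0 ∷ 1 ∷ 2 ∷ 3 ∷ 0 ∷ 2 ∷ 1 ∷ 1 ∷ 3 ∷ 0 ∷ 3 ∷ 2 ∷ 3 ∷ 1 ∷ 0 ∷ 2 ∷ 1 ∷ 0 ∷ 2 ∷ 3 ∷ [])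
  ∷ (0 ∷ 1 ∷ 2 ∷ 3 ∷ 0 ∷ 2 ∷ 1 ∷ 3 ∷ 1 ∷ 0 ∷ 2 ∷ 3 ∷ 1 ∷ 2 ∷ 3 ∷ 0 ∷ 3 ∷ 1 ∷ 2 ∷ 0 ∷ [])
  ∷ (0 ∷ 1 ∷ 2 ∷ 3 ∷ 0 ∷ 2 ∷ 1 ∷ 3 ∷ 1 ∷ 0 ∷ 3 ∷ 2 ∷ 1 ∷ 3 ∷ 2 ∷ 0 ∷ 2 ∷ 1 ∷ 3 ∷ 0 ∷ [])
  ∷ (0 ∷ 1 ∷ 2 ∷ 3 ∷ 1 ∷ 0 ∷ 2 ∷ 1 ∷ 2 ∷ 3 ∷ 0 ∷ 2 ∷ 3 ∷ 0 ∷ 3 ∷ 1 ∷ 2 ∷ 3 ∷ 1 ∷ 0 ∷ [])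
  ∷ (0 ∷ 1 ∷ 2 ∷ 3 ∷ 1 ∷ 0 ∷ 2 ∷ 1 ∷ 2 ∷ 3 ∷ 2 ∷ 0 ∷ 2 ∷ 3 ∷ 0 ∷ 1 ∷ 3 ∷ 0 ∷ 1 ∷ 3 ∷ [])
  ∷ (0 ∷ 1 ∷ 2 ∷ 3 ∷ 1 ∷ 0 ∷ 2 ∷ 1 ∷ 2 ∷ 3 ∷ 2 ∷ 0 ∷ 2 ∷ 3 ∷ 1 ∷ 0 ∷ 1 ∷ 3 ∷ 3 ∷ 0 ∷ [])
  ∷ (0 ∷ 1 ∷ 2 ∷ 3 ∷ 1 ∷ 0 ∷ 2 ∷ 1 ∷ 3 ∷ 2 ∷ 0 ∷ 3 ∷ 2 ∷ 0 ∷ 1 ∷ 2 ∷ 1 ∷ 3 ∷ 3 ∷ 0 ∷ [])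
  ∷ (0 ∷ 1 ∷ 2 ∷ 3 ∷ 1 ∷ 0 ∷ 2 ∷ 1 ∷ 3 ∷ 2 ∷ 3 ∷ 0 ∷ 3 ∷ 2 ∷ 0 ∷ 1 ∷ 2 ∷ 0 ∷ 1 ∷ 3 ∷ [])
  ∷ (0 ∷ 1 ∷ 2 ∷ 3 ∷ 1 ∷ 0 ∷ 2 ∷ 3 ∷ 1 ∷ 2 ∷ 0 ∷ 3 ∷ 2 ∷ 0 ∷ 3 ∷ 2 ∷ 3 ∷ 1 ∷ 1 ∷ 0 ∷ [])
  ∷ (0 ∷ 1 ∷ 2 ∷ 3 ∷ 1 ∷ 0 ∷ 2 ∷ 3 ∷ 1 ∷ 2 ∷ 3 ∷ 0 ∷ 2 ∷ 3 ∷ 0 ∷ 2 ∷ 1 ∷ 0 ∷ 3 ∷ 1 ∷ [])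
  ∷ (0 ∷ 1 ∷ 2 ∷ 3 ∷ 1 ∷ 0 ∷ 2 ∷ 3 ∷ 1 ∷ 2 ∷ 3 ∷ 0 ∷ 3 ∷ 2 ∷ 3 ∷ 0 ∷ 2 ∷ 1 ∷ 1 ∷ 0 ∷ [])
  ∷ (0 ∷ 1 ∷ 2 ∷ 3 ∷ 1 ∷ 2 ∷ 0 ∷ 0 ∷ 1 ∷ 3 ∷ 0 ∷ 2 ∷ 3 ∷ 0 ∷ 2 ∷ 3 ∷ 2 ∷ 1 ∷ 1 ∷ 3 ∷ [])
  ∷ (0 ∷ 1 ∷ 2 ∷ 3 ∷ 1 ∷ 2 ∷ 0 ∷ 0 ∷ 1 ∷ 3 ∷ 0 ∷ 2 ∷ 3 ∷ 0 ∷ 3 ∷ 2 ∷ 1 ∷ 3 ∷ 2 ∷ 1 ∷ [])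
  ∷ (0 ∷ 1 ∷ 2 ∷ 3 ∷ 1 ∷ 2 ∷ 0 ∷ 0 ∷ 1 ∷ 3 ∷ 2 ∷ 0 ∷ 2 ∷ 3 ∷ 2 ∷ 0 ∷ 1 ∷ 3 ∷ 3 ∷ 1 ∷ [])
  ∷ (0 ∷ 1 ∷ 2 ∷ 3 ∷ 1 ∷ 2 ∷ 0 ∷ 0 ∷ 1 ∷ 3 ∷ 2 ∷ 0 ∷ 2 ∷ 3 ∷ 2 ∷ 0 ∷ 3 ∷ 1 ∷ 1 ∷ 3 ∷ [])
  ∷ (0 ∷ 1 ∷ 2 ∷ 3 ∷ 1 ∷ 2 ∷ 0 ∷ 0 ∷ 1 ∷ 3 ∷ 2 ∷ 0 ∷ 3 ∷ 2 ∷ 3 ∷ 0 ∷ 1 ∷ 3 ∷ 2 ∷ 1 ∷ [])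
  ∷ (0 ∷ 1 ∷ 2 ∷ 3 ∷ 1 ∷ 2 ∷ 0 ∷ 1 ∷ 0 ∷ 3 ∷ 2 ∷ 0 ∷ 2 ∷ 3 ∷ 2 ∷ 1 ∷ 3 ∷ 0 ∷ 1 ∷ 3 ∷ [])
  ∷ (0 ∷ 1 ∷ 2 ∷ 3 ∷ 1 ∷ 2 ∷ 0 ∷ 1 ∷ 0 ∷ 3 ∷ 2 ∷ 0 ∷ 3 ∷ 2 ∷ 1 ∷ 3 ∷ 1 ∷ 0 ∷ 2 ∷ 3 ∷ [])
  ∷ (0 ∷ 1 ∷ 2 ∷ 3 ∷ 1 ∷ 2 ∷ 0 ∷ 1 ∷ 3 ∷ 0 ∷ 2 ∷ 3 ∷ 2 ∷ 0 ∷ 2 ∷ 1 ∷ 3 ∷ 0 ∷ 1 ∷ 3 ∷ [])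
  ∷ (0 ∷ 1 ∷ 2 ∷ 3 ∷ 1 ∷ 2 ∷ 0 ∷ 1 ∷ 3 ∷ 0 ∷ 3 ∷ 2 ∷ 3 ∷ 0 ∷ 1 ∷ 2 ∷ 1 ∷ 0 ∷ 2 ∷ 3 ∷ [])
  ∷ (0 ∷ 1 ∷ 2 ∷ 3 ∷ 1 ∷ 2 ∷ 0 ∷ 1 ∷ 3 ∷ 0 ∷ 3 ∷ 2 ∷ 3 ∷ 0 ∷ 2 ∷ 1 ∷ 2 ∷ 0 ∷ 1 ∷ 3 ∷ [])
  ∷ (0 ∷ 1 ∷ 2 ∷ 3 ∷ 1 ∷ 2 ∷ 0 ∷ 3 ∷ 1 ∷ 0 ∷ 2 ∷ 3 ∷ 2 ∷ 0 ∷ 2 ∷ 3 ∷ 1 ∷ 0 ∷ 3 ∷ 1 ∷ [])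
  ∷ (0 ∷ 1 ∷ 2 ∷ 3 ∷ 1 ∷ 2 ∷ 0 ∷ 3 ∷ 1 ∷ 0 ∷ 3 ∷ 2 ∷ 3 ∷ 0 ∷ 3 ∷ 2 ∷ 1 ∷ 0 ∷ 2 ∷ 1 ∷ [])
  ∷ (0 ∷ 1 ∷ 2 ∷ 3 ∷ 2 ∷ 0 ∷ 1 ∷ 1 ∷ 2 ∷ 3 ∷ 2 ∷ 0 ∷ 1 ∷ 3 ∷ 0 ∷ 1 ∷ 3 ∷ 0 ∷ 2 ∷ 3 ∷ [])
  ∷ (0 ∷ 1 ∷ 2 ∷ 3 ∷ 2 ∷ 0 ∷ 1 ∷ 1 ∷ 2 ∷ 3 ∷ 2 ∷ 0 ∷ 3 ∷ 1 ∷ 0 ∷ 3 ∷ 1 ∷ 0 ∷ 2 ∷ 3 ∷ [])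
  ∷ (0 ∷ 1 ∷ 2 ∷ 3 ∷ 2 ∷ 0 ∷ 1 ∷ 1 ∷ 2 ∷ 3 ∷ 2 ∷ 0 ∷ 3 ∷ 1 ∷ 3 ∷ 0 ∷ 1 ∷ 3 ∷ 2 ∷ 0 ∷ [])
  ∷ (0 ∷ 1 ∷ 2 ∷ 3 ∷ 2 ∷ 0 ∷ 1 ∷ 1 ∷ 3 ∷ 2 ∷ 0 ∷ 3 ∷ 1 ∷ 0 ∷ 2 ∷ 1 ∷ 2 ∷ 3 ∷ 3 ∷ 0 ∷ [])
  ∷ (0 ∷ 1 ∷ 2 ∷ 3 ∷ 2 ∷ 0 ∷ 1 ∷ 1 ∷ 3 ∷ 2 ∷ 3 ∷ 0 ∷ 3 ∷ 1 ∷ 0 ∷ 2 ∷ 1 ∷ 0 ∷ 2 ∷ 3 ∷ [])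
  ∷ (0 ∷ 1 ∷ 2 ∷ 3 ∷ 2 ∷ 0 ∷ 1 ∷ 3 ∷ 1 ∷ 2 ∷ 0 ∷ 3 ∷ 1 ∷ 0 ∷ 2 ∷ 3 ∷ 2 ∷ 1 ∷ 3 ∷ 0 ∷ [])
  ∷ (0 ∷ 1 ∷ 2 ∷ 3 ∷ 2 ∷ 0 ∷ 1 ∷ 3 ∷ 1 ∷ 2 ∷ 0 ∷ 3 ∷ 1 ∷ 0 ∷ 3 ∷ 2 ∷ 3 ∷ 1 ∷ 2 ∷ 0 ∷ [])
  ∷ (0 ∷ 1 ∷ 2 ∷ 3 ∷ 2 ∷ 0 ∷ 1 ∷ 3 ∷ 1 ∷ 2 ∷ 3 ∷ 0 ∷ 1 ∷ 3 ∷ 2 ∷ 0 ∷ 2 ∷ 1 ∷ 3 ∷ 0 ∷ [])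
  ∷ (0 ∷ 1 ∷ 2 ∷ 3 ∷ 2 ∷ 1 ∷ 0 ∷ 0 ∷ 2 ∷ 3 ∷ 2 ∷ 0 ∷ 1 ∷ 3 ∷ 1 ∷ 0 ∷ 3 ∷ 1 ∷ 2 ∷ 3 ∷ [])
  ∷ (0 ∷ 1 ∷ 2 ∷ 3 ∷ 2 ∷ 1 ∷ 0 ∷ 0 ∷ 2 ∷ 3 ∷ 2 ∷ 0 ∷ 3 ∷ 1 ∷ 3 ∷ 0 ∷ 1 ∷ 3 ∷ 2 ∷ 1 ∷ [])
  ∷ (0 ∷ 1 ∷ 2 ∷ 3 ∷ 2 ∷ 1 ∷ 0 ∷ 0 ∷ 3 ∷ 2 ∷ 0 ∷ 3 ∷ 1 ∷ 0 ∷ 1 ∷ 2 ∷ 3 ∷ 1 ∷ 2 ∷ 3 ∷ [])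
  ∷ (0 ∷ 1 ∷ 2 ∷ 3 ∷ 2 ∷ 1 ∷ 0 ∷ 0 ∷ 3 ∷ 2 ∷ 0 ∷ 3 ∷ 1 ∷ 0 ∷ 2 ∷ 1 ∷ 2 ∷ 3 ∷ 3 ∷ 1 ∷ [])
  ∷ (0 ∷ 1 ∷ 2 ∷ 3 ∷ 2 ∷ 1 ∷ 0 ∷ 0 ∷ 3 ∷ 2 ∷ 3 ∷ 0 ∷ 3 ∷ 1 ∷ 2 ∷ 0 ∷ 2 ∷ 1 ∷ 1 ∷ 3 ∷ [])
  ∷ (0 ∷ 1 ∷ 2 ∷ 3 ∷ 2 ∷ 1 ∷ 0 ∷ 3 ∷ 0 ∷ 2 ∷ 3 ∷ 0 ∷ 1 ∷ 3 ∷ 2 ∷ 1 ∷ 2 ∷ 0 ∷ 3 ∷ 1 ∷ [])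
  ∷ (0 ∷ 1 ∷ 2 ∷ 3 ∷ 2 ∷ 1 ∷ 0 ∷ 3 ∷ 0 ∷ 2 ∷ 3 ∷ 0 ∷ 3 ∷ 1 ∷ 3 ∷ 2 ∷ 1 ∷ 0 ∷ 2 ∷ 1 ∷ [])
  ∷ (0 ∷ 1 ∷ 2 ∷ 3 ∷ 2 ∷ 1 ∷ 0 ∷ 3 ∷ 2 ∷ 0 ∷ 2 ∷ 3 ∷ 1 ∷ 0 ∷ 3 ∷ 1 ∷ 3 ∷ 0 ∷ 2 ∷ 1 ∷ [])
  ∷ []

classes₂ : Vec (Vec ℕ 4) 56
classes₂ =
    (0 ∷ 1 ∷ 2 ∷ 3 ∷ [])
  ∷ (0 ∷ 4 ∷ 2 ∷ 5 ∷ [])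
  ∷ (0 ∷ 1 ∷ 6 ∷ 7 ∷ [])
  ∷ (0 ∷ 8 ∷ 9 ∷ 7 ∷ [])
  ∷ (0 ∷ 4 ∷ 9 ∷ 10 ∷ [])
  ∷ (11 ∷ 12 ∷ 6 ∷ 13 ∷ [])
  ∷ (11 ∷ 4 ∷ 9 ∷ 14 ∷ [])
  ∷ (15 ∷ 8 ∷ 16 ∷ 13 ∷ [])
  ∷ (17 ∷ 4 ∷ 16 ∷ 14 ∷ [])
  ∷ (15 ∷ 1 ∷ 2 ∷ 18 ∷ [])
  ∷ (17 ∷ 12 ∷ 2 ∷ 18 ∷ [])
  ∷ (17 ∷ 4 ∷ 2 ∷ 19 ∷ [])
  ∷ (0 ∷ 20 ∷ 21 ∷ 22 ∷ [])
  ∷ (11 ∷ 23 ∷ 24 ∷ 3 ∷ [])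
  ∷ (11 ∷ 25 ∷ 21 ∷ 26 ∷ [])
  ∷ (15 ∷ 23 ∷ 27 ∷ 10 ∷ [])
  ∷ (17 ∷ 25 ∷ 28 ∷ 7 ∷ [])
  ∷ (15 ∷ 25 ∷ 21 ∷ 29 ∷ [])
  ∷ (17 ∷ 20 ∷ 27 ∷ 14 ∷ [])
  ∷ (17 ∷ 20 ∷ 24 ∷ 18 ∷ [])
  ∷ (30 ∷ 31 ∷ 2 ∷ 26 ∷ [])
  ∷ (32 ∷ 31 ∷ 16 ∷ 22 ∷ [])
  ∷ (33 ∷ 34 ∷ 16 ∷ 3 ∷ [])
  ∷ (30 ∷ 34 ∷ 9 ∷ 7 ∷ [])
  ∷ (32 ∷ 31 ∷ 6 ∷ 29 ∷ [])
  ∷ (30 ∷ 35 ∷ 9 ∷ 14 ∷ [])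
  ∷ (32 ∷ 36 ∷ 9 ∷ 18 ∷ [])
  ∷ (33 ∷ 35 ∷ 6 ∷ 19 ∷ [])
  ∷ (37 ∷ 35 ∷ 24 ∷ 5 ∷ [])
  ∷ (37 ∷ 36 ∷ 21 ∷ 26 ∷ [])
  ∷ (38 ∷ 36 ∷ 28 ∷ 3 ∷ [])
  ∷ (38 ∷ 35 ∷ 28 ∷ 22 ∷ [])
  ∷ (38 ∷ 36 ∷ 27 ∷ 26 ∷ [])
  ∷ (39 ∷ 31 ∷ 28 ∷ 22 ∷ [])
  ∷ (39 ∷ 34 ∷ 27 ∷ 5 ∷ [])
  ∷ (40 ∷ 31 ∷ 28 ∷ 10 ∷ [])
  ∷ (40 ∷ 34 ∷ 21 ∷ 29 ∷ [])
  ∷ (40 ∷ 31 ∷ 24 ∷ 29 ∷ [])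
  ∷ (40 ∷ 36 ∷ 28 ∷ 13 ∷ [])
  ∷ (40 ∷ 36 ∷ 21 ∷ 19 ∷ [])
  ∷ (32 ∷ 23 ∷ 41 ∷ 22 ∷ [])
  ∷ (32 ∷ 25 ∷ 41 ∷ 5 ∷ [])
  ∷ (33 ∷ 25 ∷ 41 ∷ 26 ∷ [])
  ∷ (30 ∷ 23 ∷ 42 ∷ 7 ∷ [])
  ∷ (32 ∷ 25 ∷ 43 ∷ 29 ∷ [])
  ∷ (30 ∷ 20 ∷ 42 ∷ 13 ∷ [])
  ∷ (30 ∷ 20 ∷ 43 ∷ 14 ∷ [])
  ∷ (33 ∷ 20 ∷ 42 ∷ 18 ∷ [])
  ∷ (38 ∷ 12 ∷ 41 ∷ 22 ∷ [])
  ∷ (38 ∷ 8 ∷ 41 ∷ 26 ∷ [])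
  ∷ (37 ∷ 12 ∷ 43 ∷ 10 ∷ [])
  ∷ (37 ∷ 1 ∷ 42 ∷ 7 ∷ [])
  ∷ (38 ∷ 4 ∷ 42 ∷ 29 ∷ [])
  ∷ (39 ∷ 1 ∷ 42 ∷ 18 ∷ [])
  ∷ (39 ∷ 8 ∷ 43 ∷ 19 ∷ [])
  ∷ (40 ∷ 1 ∷ 41 ∷ 14 ∷ [])
  ∷ []

classColouring₂ : Vec ℕ 44
classColouring₂ = 0 ∷ 0 ∷ 0 ∷ 0 ∷ 1 ∷ 1 ∷ 2 ∷ 2 ∷ 3 ∷ 3 ∷ 4 ∷ 5 ∷ 5 ∷ 5 ∷ 6 ∷ 7 ∷ 7 ∷ 8 ∷ 9 ∷ 11 ∷ 12 ∷ 12 ∷ 12 ∷ 13 ∷ 13 ∷ 14 ∷ 14 ∷ 15 ∷ 16 ∷ 17 ∷ 20 ∷ 20 ∷ 21 ∷ 22 ∷ 22 ∷ 25 ∷ 26 ∷ 28 ∷ 30 ∷ 33 ∷ 35 ∷ 40 ∷ 43 ∷ 44 ∷ []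

classColour₂ : Vec ℕ 44
classColour₂ = 0 ∷ 1 ∷ 2 ∷ 3 ∷ 1 ∷ 3 ∷ 2 ∷ 3 ∷ 1 ∷ 2 ∷ 3 ∷ 0 ∷ 1 ∷ 3 ∷ 3 ∷ 0 ∷ 2 ∷ 0 ∷ 3 ∷ 3 ∷ 1 ∷ 2 ∷ 3 ∷ 1 ∷ 2 ∷ 1 ∷ 3 ∷ 2 ∷ 2 ∷ 3 ∷ 0 ∷ 1 ∷ 0 ∷ 0 ∷ 1 ∷ 1 ∷ 1 ∷ 0 ∷ 0 ∷ 0 ∷ 0 ∷ 2 ∷ 2 ∷ 2 ∷ []

earlier₂ : ℕ → List ℕ
earlier₂ 0 = []
earlier₂ 1 = 0 ∷ []
earlier₂ 2 = 0 ∷ 1 ∷ []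
earlier₂ 3 = 0 ∷ 1 ∷ 2 ∷ []
earlier₂ 4 = 3 ∷ []
earlier₂ 5 = 3 ∷ 4 ∷ []
earlier₂ 6 = 3 ∷ 4 ∷ 5 ∷ []
earlier₂ 7 = 2 ∷ 5 ∷ []
earlier₂ 8 = 5 ∷ 7 ∷ []
earlier₂ 9 = 1 ∷ 5 ∷ 7 ∷ 8 ∷ []
earlier₂ 10 = 1 ∷ 9 ∷ []
earlier₂ 11 = 1 ∷ 4 ∷ 9 ∷ 10 ∷ []
earlier₂ 12 = 0 ∷ 4 ∷ 11 ∷ []
earlier₂ 13 = 4 ∷ 8 ∷ 11 ∷ 12 ∷ []
earlier₂ 14 = 6 ∷ 8 ∷ 13 ∷ []
earlier₂ 15 = 8 ∷ 10 ∷ 13 ∷ 14 ∷ []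
earlier₂ 16 = 0 ∷ 10 ∷ 12 ∷ 15 ∷ []
earlier₂ 17 = 2 ∷ 7 ∷ 10 ∷ 15 ∷ 16 ∷ []
earlier₂ 18 = 0 ∷ 6 ∷ 12 ∷ 14 ∷ 16 ∷ []
earlier₂ 19 = 2 ∷ 6 ∷ 7 ∷ 14 ∷ 17 ∷ 18 ∷ []
earlier₂ _ = []

colour₂ : Fin 56 → Fin 20 → Fin 4
colour₂ t v = entry (lookup (lookup colours₂ t) v)

classOf₂ : Fin 56 → Fin 4 → Fin 44
classOf₂ t a = entry (lookup (lookup classes₂ t) a)

T₂ : Complex
T₂ = TableComplex classOf₂

T₂-setoid : IsSetoidComplex T₂
T₂-setoid = finite-setoid (RowFace classOf₂)

module Tab₂ = Tabulated colour₂ classOf₂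
                        (λ i → entry (lookup classColouring₂ i)) (λ i → entry (lookup classColour₂ i))

opaque
  rows-proper₂ : ∀ t s a b → classOf₁ s a ≡ classOf₁ s b ⊎
                             colour₂ t (classOf₁ s a) ≢ colour₂ t (classOf₁ s b)
  rows-proper₂ = from-yes (all? λ (t : Fin 56) → all? λ (s : Fin 10) →
    all? λ (a : Fin 4) → all? λ (b : Fin 4) →
    (classOf₁ s a ≟ classOf₁ s b) ⊎-dec ¬? (colour₂ t (classOf₁ s a) ≟ colour₂ t (classOf₁ s b)))

module Search₂ = ColouringSearch {3} {20} earlier₂ Tab₂.Matches Tab₂.matches? Tab₂.matches-resp

opaque
  earlier₂-ordered : Search₂.Ordered
  earlier₂-ordered = from-yes (all? λ (i : Fin 20) → All.all? (λ j → j ℕ.<? toℕ i) (earlier₂ (toℕ i)))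

opaque
  earlier₂-adjacent : ∀ (i j : Fin 20) → toℕ j ∈ earlier₂ (toℕ i) →
                      (∃[ s ] ∃[ a ] ∃[ b ] j ≡ classOf₁ s a × i ≡ classOf₁ s b) × j ≢ i
  earlier₂-adjacent = from-yes (all? λ (i : Fin 20) → all? λ (j : Fin 20) →
     Any.any? (toℕ j ℕ.≟_) (earlier₂ (toℕ i)) →-dec
     ((any? λ (s : Fin 10) → any? λ (a : Fin 4) → any? λ (b : Fin 4) →
         (j ≟ classOf₁ s a) ×-dec (i ≟ classOf₁ s b)) ×-dec ¬? (j ≟ i)))

earlier₂-spanning : Search₂.Spanning (RowFace classOf₁)
earlier₂-spanning i j j∈ =
  let ((s , a , b , j≡ , i≡) , j≢i) = earlier₂-adjacent i j j∈
  in (s , (a , j≡) ∷ (b , i≡) ∷ []) , j≢i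

opaque
  first-row-injective : ∀ a b → classOf₁ zero a ≡ classOf₁ zero b → a ≡ b
  first-row-injective = from-yes (all? λ (a : Fin 4) → all? λ (b : Fin 4) →
    (classOf₁ zero a ≟ classOf₁ zero b) →-dec (a ≟ b))

-- The search only
-- runs through colourings normalised to colour i on the vertex i of the
-- first facet {0, 1, 2, 3}; an arbitrary colouring is normalised by the
-- inverse of its colouring of that facet.
complete₂ : (f : Coloring 4 T₁) → ∃[ t ] IsRenaming (proj₁ f) (colour₂ t)
complete₂ (f , f-cong , f-proper) =
  from-normalised (Search₂.search-sound-from 16 4 refl earlier₂-ordered h h-proper
                     (subst (T ∘ Search₂.search 16 4) (sym start) _))
  where
  φ : Fin 4 → Fin 4
  φ a = f (classOf₁ zero a)
  φ-inj : ∀ {a b} → φ a ≡ φ b → a ≡ b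
  φ-inj {a} {b} eq with a ≟ b
  ... | yes a≡b = a≡b
  ... | no  a≢b = ⊥-elim (f-proper _ _ (zero , (a , refl) ∷ (b , refl) ∷ [])
                                   (a≢b ∘ first-row-injective a b) eq)
  ρ : Fin 4 → Fin 4
  ρ c = proj₁ (injective⇒surjective φ φ-inj c)
  φ∘ρ : ∀ c → φ (ρ c) ≡ c
  φ∘ρ c = proj₂ (injective⇒surjective φ φ-inj c)
  h : Fin 20 → Fin 4
  h v = ρ (f v)
  h-proper : ∀ i j → toℕ j ∈ earlier₂ (toℕ i) → h j ≢ h i
  h-proper i j j∈ hj≡hi = let (edge , j≢i) = earlier₂-spanning i j j∈ in
    f-proper j i edge j≢i (trans (sym (φ∘ρ (f j))) (trans (cong φ hj≡hi) (φ∘ρ (f i))))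
  normalised : ∀ a → h (classOf₁ zero a) ≡ a
  normalised a = φ-inj (φ∘ρ (φ a))
  start : Search₂.Along.prefix (Search₂.extend h) 4 ≡ entry 3 ∷ entry 2 ∷ entry 1 ∷ entry 0 ∷ []
  start = cong₂ _∷_ (normalised (entry 3)) (cong₂ _∷_ (normalised (entry 2))
            (cong₂ _∷_ (normalised (entry 1)) (cong₂ _∷_ (normalised (entry 0)) refl)))
  from-normalised : Tab₂.Matches h → ∃[ t ] IsRenaming f (colour₂ t)
  from-normalised (t , h≗t) = t , φ , φ-inj , λ v → trans (sym (φ∘ρ (f v))) (cong φ (h≗t v))

table₂ : ColouringTable 4 20 (RowFace classOf₁)
table₂ = Tab₂.table {RowFace classOf₁}
  (λ { t u v (s , (a , refl) ∷ (b , refl) ∷ []) u≢v →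
         [ (λ u≡v → ⊥-elim (u≢v u≡v)) , (λ differ → differ) ]′ (rows-proper₂ t s a b) })
  complete₂

B²-icosahedron : B² 4 Icosahedron ≅ T₂
B²-icosahedron =
  ≅-trans (B-setoid 4 (B 4 Icosahedron)) T₂-setoid
    (B-cong (B-setoid 4 Icosahedron) (finite-setoid (RowFace classOf₁)) B-icosahedron)
    (B-classification table₂)

-- The 44 derangements of {0, …, 4}; derangement k is the vertex k of T₂.
derangementsV : Vec (Vec ℕ 5) 44
derangementsV =
    (1 ∷ 2 ∷ 3 ∷ 4 ∷ 0 ∷ [])
  ∷ (2 ∷ 0 ∷ 4 ∷ 1 ∷ 3 ∷ [])
  ∷ (4 ∷ 3 ∷ 0 ∷ 2 ∷ 1 ∷ [])
  ∷ (3 ∷ 4 ∷ 1 ∷ 0 ∷ 2 ∷ [])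
  ∷ (2 ∷ 4 ∷ 1 ∷ 0 ∷ 3 ∷ [])
  ∷ (3 ∷ 0 ∷ 4 ∷ 1 ∷ 2 ∷ [])
  ∷ (3 ∷ 4 ∷ 0 ∷ 2 ∷ 1 ∷ [])
  ∷ (4 ∷ 3 ∷ 1 ∷ 0 ∷ 2 ∷ [])
  ∷ (2 ∷ 4 ∷ 0 ∷ 1 ∷ 3 ∷ [])
  ∷ (3 ∷ 0 ∷ 4 ∷ 2 ∷ 1 ∷ [])
  ∷ (4 ∷ 3 ∷ 0 ∷ 1 ∷ 2 ∷ [])
  ∷ (4 ∷ 2 ∷ 3 ∷ 1 ∷ 0 ∷ [])
  ∷ (2 ∷ 0 ∷ 1 ∷ 4 ∷ 3 ∷ [])
  ∷ (1 ∷ 3 ∷ 4 ∷ 0 ∷ 2 ∷ [])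
  ∷ (1 ∷ 3 ∷ 0 ∷ 4 ∷ 2 ∷ [])
  ∷ (3 ∷ 2 ∷ 1 ∷ 4 ∷ 0 ∷ [])
  ∷ (4 ∷ 0 ∷ 3 ∷ 2 ∷ 1 ∷ [])
  ∷ (3 ∷ 2 ∷ 4 ∷ 1 ∷ 0 ∷ [])
  ∷ (1 ∷ 4 ∷ 3 ∷ 0 ∷ 2 ∷ [])
  ∷ (1 ∷ 0 ∷ 3 ∷ 4 ∷ 2 ∷ [])
  ∷ (4 ∷ 0 ∷ 1 ∷ 2 ∷ 3 ∷ [])
  ∷ (2 ∷ 3 ∷ 4 ∷ 0 ∷ 1 ∷ [])
  ∷ (3 ∷ 4 ∷ 0 ∷ 1 ∷ 2 ∷ [])
  ∷ (1 ∷ 0 ∷ 4 ∷ 2 ∷ 3 ∷ [])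
  ∷ (2 ∷ 3 ∷ 0 ∷ 4 ∷ 1 ∷ [])
  ∷ (1 ∷ 4 ∷ 0 ∷ 2 ∷ 3 ∷ [])
  ∷ (3 ∷ 0 ∷ 1 ∷ 4 ∷ 2 ∷ [])
  ∷ (2 ∷ 4 ∷ 3 ∷ 0 ∷ 1 ∷ [])
  ∷ (2 ∷ 0 ∷ 3 ∷ 4 ∷ 1 ∷ [])
  ∷ (4 ∷ 0 ∷ 3 ∷ 1 ∷ 2 ∷ [])
  ∷ (2 ∷ 4 ∷ 3 ∷ 1 ∷ 0 ∷ [])
  ∷ (1 ∷ 2 ∷ 4 ∷ 0 ∷ 3 ∷ [])
  ∷ (2 ∷ 3 ∷ 1 ∷ 4 ∷ 0 ∷ [])
  ∷ (2 ∷ 3 ∷ 4 ∷ 1 ∷ 0 ∷ [])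
  ∷ (1 ∷ 2 ∷ 0 ∷ 4 ∷ 3 ∷ [])
  ∷ (4 ∷ 2 ∷ 1 ∷ 0 ∷ 3 ∷ [])
  ∷ (4 ∷ 2 ∷ 0 ∷ 1 ∷ 3 ∷ [])
  ∷ (1 ∷ 4 ∷ 3 ∷ 2 ∷ 0 ∷ [])
  ∷ (1 ∷ 3 ∷ 4 ∷ 2 ∷ 0 ∷ [])
  ∷ (4 ∷ 3 ∷ 1 ∷ 2 ∷ 0 ∷ [])
  ∷ (3 ∷ 4 ∷ 1 ∷ 2 ∷ 0 ∷ [])
  ∷ (4 ∷ 2 ∷ 3 ∷ 0 ∷ 1 ∷ [])
  ∷ (3 ∷ 2 ∷ 0 ∷ 4 ∷ 1 ∷ [])
  ∷ (3 ∷ 2 ∷ 4 ∷ 0 ∷ 1 ∷ [])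
  ∷ []

-- The facets of T₂ containing a given vertex.
facetsThroughV : Vec (List ℕ) 44
facetsThroughV =
    (0 ∷ 1 ∷ 2 ∷ 3 ∷ 4 ∷ 12 ∷ [])
  ∷ (0 ∷ 2 ∷ 9 ∷ 51 ∷ 53 ∷ 55 ∷ [])
  ∷ (0 ∷ 1 ∷ 9 ∷ 10 ∷ 11 ∷ 20 ∷ [])
  ∷ (0 ∷ 13 ∷ 22 ∷ 30 ∷ [])
  ∷ (1 ∷ 4 ∷ 6 ∷ 8 ∷ 11 ∷ 52 ∷ [])
  ∷ (1 ∷ 28 ∷ 34 ∷ 41 ∷ [])
  ∷ (2 ∷ 5 ∷ 24 ∷ 27 ∷ [])
  ∷ (2 ∷ 3 ∷ 16 ∷ 23 ∷ 43 ∷ 51 ∷ [])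
  ∷ (3 ∷ 7 ∷ 49 ∷ 54 ∷ [])
  ∷ (3 ∷ 4 ∷ 6 ∷ 23 ∷ 25 ∷ 26 ∷ [])
  ∷ (4 ∷ 15 ∷ 35 ∷ 50 ∷ [])
  ∷ (5 ∷ 6 ∷ 13 ∷ 14 ∷ [])
  ∷ (5 ∷ 10 ∷ 48 ∷ 50 ∷ [])
  ∷ (5 ∷ 7 ∷ 38 ∷ 45 ∷ [])
  ∷ (6 ∷ 8 ∷ 18 ∷ 25 ∷ 46 ∷ 55 ∷ [])
  ∷ (7 ∷ 9 ∷ 15 ∷ 17 ∷ [])
  ∷ (7 ∷ 8 ∷ 21 ∷ 22 ∷ [])
  ∷ (8 ∷ 10 ∷ 11 ∷ 16 ∷ 18 ∷ 19 ∷ [])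
  ∷ (9 ∷ 10 ∷ 19 ∷ 26 ∷ 47 ∷ 53 ∷ [])
  ∷ (11 ∷ 27 ∷ 39 ∷ 54 ∷ [])
  ∷ (12 ∷ 18 ∷ 19 ∷ 45 ∷ 46 ∷ 47 ∷ [])
  ∷ (12 ∷ 14 ∷ 17 ∷ 29 ∷ 36 ∷ 39 ∷ [])
  ∷ (12 ∷ 21 ∷ 31 ∷ 33 ∷ 40 ∷ 48 ∷ [])
  ∷ (13 ∷ 15 ∷ 40 ∷ 43 ∷ [])
  ∷ (13 ∷ 19 ∷ 28 ∷ 37 ∷ [])
  ∷ (14 ∷ 16 ∷ 17 ∷ 41 ∷ 42 ∷ 44 ∷ [])
  ∷ (14 ∷ 20 ∷ 29 ∷ 32 ∷ 42 ∷ 49 ∷ [])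
  ∷ (15 ∷ 18 ∷ 32 ∷ 34 ∷ [])
  ∷ (16 ∷ 30 ∷ 31 ∷ 33 ∷ 35 ∷ 38 ∷ [])
  ∷ (17 ∷ 24 ∷ 36 ∷ 37 ∷ 44 ∷ 52 ∷ [])
  ∷ (20 ∷ 23 ∷ 25 ∷ 43 ∷ 45 ∷ 46 ∷ [])
  ∷ (20 ∷ 21 ∷ 24 ∷ 33 ∷ 35 ∷ 37 ∷ [])
  ∷ (21 ∷ 24 ∷ 26 ∷ 40 ∷ 41 ∷ 44 ∷ [])
  ∷ (22 ∷ 27 ∷ 42 ∷ 47 ∷ [])
  ∷ (22 ∷ 23 ∷ 34 ∷ 36 ∷ [])
  ∷ (25 ∷ 27 ∷ 28 ∷ 31 ∷ [])
  ∷ (26 ∷ 29 ∷ 30 ∷ 32 ∷ 38 ∷ 39 ∷ [])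
  ∷ (28 ∷ 29 ∷ 50 ∷ 51 ∷ [])
  ∷ (30 ∷ 31 ∷ 32 ∷ 48 ∷ 49 ∷ 52 ∷ [])
  ∷ (33 ∷ 34 ∷ 53 ∷ 54 ∷ [])
  ∷ (35 ∷ 36 ∷ 37 ∷ 38 ∷ 39 ∷ 55 ∷ [])
  ∷ (40 ∷ 41 ∷ 42 ∷ 48 ∷ 49 ∷ 55 ∷ [])
  ∷ (43 ∷ 45 ∷ 47 ∷ 51 ∷ 52 ∷ 53 ∷ [])
  ∷ (44 ∷ 46 ∷ 50 ∷ 54 ∷ [])
  ∷ []

derangement : Fin 44 → Fin 5 → Fin 5
derangement k i = entry (lookup (lookup derangementsV k) i)

facetsThrough : Fin 44 → List (Fin 56)
facetsThrough k = map entry (lookup facetsThroughV k)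

opaque
  derangement-facts : ∀ k → (∀ i j → derangement k i ≡ derangement k j → i ≡ j) ×
                            (∀ i → derangement k i ≢ i)
  derangement-facts = from-yes (all? λ (k : Fin 44) →
    (all? λ (i : Fin 5) → all? λ (j : Fin 5) → (derangement k i ≟ derangement k j) →-dec (i ≟ j))
    ×-dec (all? λ (i : Fin 5) → ¬? (derangement k i ≟ i)))

  derangement-injective : ∀ k l → (∀ i → derangement k i ≡ derangement l i) → k ≡ l
  derangement-injective = from-yes (all? λ (k : Fin 44) → all? λ (l : Fin 44) →
    (all? λ (i : Fin 5) → derangement k i ≟ derangement l i) →-dec (k ≟ l))

derangementP : Fin 44 → Perm5
derangementP k = derangement k , λ {i} {j} → proj₁ (derangement-facts k) i j

square : Fin 56 → Fin 5 → Perm5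
square t zero    = idP
square t (suc a) = derangementP (classOf₂ t a)

opaque
  square-partition : ∀ t → IsGridPartition (square t)
  square-partition = from-yes (all? λ (t : Fin 56) →
      (all? λ (i : Fin 5) → all? λ (j : Fin 5) → any? λ (a : Fin 5) → proj₁ (square t a) i ≟ j)
      ×-dec (all? λ (a : Fin 5) → all? λ (b : Fin 5) → all? λ (i : Fin 5) →
               (proj₁ (square t a) i ≟ proj₁ (square t b) i) →-dec (a ≟ b)))

-- Checked by running through
-- all injections, i.e. colourings of the complete graph on 5 vertices.
ListedDerangement : (Fin 5 → Fin 5) → Set
ListedDerangement w = (∃[ i ] w i ≡ i) ⊎ (∃[ k ] ∀ i → derangement k i ≡ w i)

listedDerangement? : ∀ w → Dec (ListedDerangement w)
listedDerangement? w = (any? λ i → w i ≟ i) ⊎-dec (any? λ k → all? λ i → derangement k i ≟ w i)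

listedDerangement-resp : ∀ {w w′} → (∀ i → w i ≡ w′ i) → ListedDerangement w → ListedDerangement w′
listedDerangement-resp w≗w′ (inj₁ (i , wi≡i)) = inj₁ (i , trans (sym (w≗w′ i)) wi≡i)
listedDerangement-resp w≗w′ (inj₂ (k , k≗w))  = inj₂ (k , λ i → trans (k≗w i) (w≗w′ i))

-- in the complete graph every smaller vertex is a neighbour
allEarlier : ℕ → List ℕ
allEarlier m = upTo m

module SearchD = ColouringSearch {4} {5} allEarlier ListedDerangement listedDerangement? listedDerangement-resp

opaque
  allEarlier-ordered : SearchD.Ordered
  allEarlier-ordered = from-yes (all? λ (i : Fin 5) → All.all? (λ j → j ℕ.<? toℕ i) (allEarlier (toℕ i)))

  allEarlier-distinct : ∀ (i j : Fin 5) → toℕ j ∈ allEarlier (toℕ i) → j ≢ i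
  allEarlier-distinct = from-yes (all? λ (i : Fin 5) → all? λ (j : Fin 5) →
    Any.any? (toℕ j ℕ.≟_) (allEarlier (toℕ i)) →-dec ¬? (j ≟ i))

  classify-derangement : (w : Perm5) → (∀ i → proj₁ w i ≢ i) →
                         ∃[ k ] ∀ i → derangement k i ≡ proj₁ w i
  classify-derangement (w , w-inj) w-der =
    [ (λ { (i , wi≡i) → ⊥-elim (w-der i wi≡i) }) , (λ found → found) ]′
      (SearchD.search-sound allEarlier-ordered _ w (λ i j j∈ wj≡wi → allEarlier-distinct i j j∈ (w-inj wj≡wi)))

diagonal-partner : (q : Fin 5 → Perm5) → IsGridPartition q → ∀ {a b} →
                   (∀ i → i ≡ proj₁ (q a) i) → a ≢ b → ∀ i → proj₁ (q b) i ≢ i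
diagonal-partner q (_ , disjoint) {a} {b} diag a≢b i qbi≡i =
  a≢b (disjoint a b i (trans (sym (diag i)) (sym qbi≡i)))

Disjoint : Fin 44 → Fin 44 → Set
Disjoint k l = ∀ i → derangement k i ≢ derangement l i

InRow : Fin 44 → Fin 56 → Set
InRow k t = ∃[ c ] k ≡ classOf₂ t c

opaque
  triple : ∀ x y → Disjoint x y → ∀ z → Disjoint x z → Disjoint y z →
           Any (λ t → InRow x t × InRow y t × InRow z t) (facetsThrough x)
  triple = from-yes (all? λ (x : Fin 44) → all? λ (y : Fin 44) → disjoint? x y →-dec all? λ (z : Fin 44) →
    disjoint? x z →-dec disjoint? y z →-dec
    Any.any? (λ t → inRow? x t ×-dec inRow? y t ×-dec inRow? z t) (facetsThrough x))
    where
    disjoint? : ∀ k l → Dec (Disjoint k l)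
    disjoint? k l = all? λ i → ¬? (derangement k i ≟ derangement l i)
    inRow? : ∀ k t → Dec (InRow k t)
    inRow? k t = any? λ c → k ≟ classOf₂ t c

  fourth-unique : ∀ (a b c d d′ : Fin 4) → a ≢ b → a ≢ c → b ≢ c →
                  d ≢ a → d ≢ b → d ≢ c → d′ ≢ a → d′ ≢ b → d′ ≢ c → d ≡ d′
  fourth-unique = from-yes (all? λ (a : Fin 4) → all? λ (b : Fin 4) → all? λ (c : Fin 4) →
    all? λ (d : Fin 4) → all? λ (d′ : Fin 4) →
    ¬? (a ≟ b) →-dec ¬? (a ≟ c) →-dec ¬? (b ≟ c) →-dec
    ¬? (d ≟ a) →-dec ¬? (d ≟ b) →-dec ¬? (d ≟ c) →-dec
    ¬? (d′ ≟ a) →-dec ¬? (d′ ≟ b) →-dec ¬? (d′ ≟ c) →-dec (d ≟ d′))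

fourth-row : ∀ t {c₀ c₁ c₂} → c₀ ≢ c₁ → c₀ ≢ c₂ → c₁ ≢ c₂ →
             (w : Fin 5 → Fin 5) → (∀ i → w i ≢ i) →
             (∀ i → w i ≢ derangement (classOf₂ t c₀) i) →
             (∀ i → w i ≢ derangement (classOf₂ t c₁) i) →
             (∀ i → w i ≢ derangement (classOf₂ t c₂) i) →
             ∃[ c ] ∀ i → derangement (classOf₂ t c) i ≡ w i
fourth-row t {c₀} {c₁} {c₂} c₀≢c₁ c₀≢c₂ c₁≢c₂ w w-der w≢₀ w≢₁ w≢₂ =
  proj₁ (covering zero) , λ i → subst (λ c → derangement (classOf₂ t c) i ≡ w i)
    (fourth-unique _ _ _ _ _ c₀≢c₁ c₀≢c₂ c₁≢c₂ (avoids i w≢₀) (avoids i w≢₁) (avoids i w≢₂)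
                                                (avoids zero w≢₀) (avoids zero w≢₁) (avoids zero w≢₂))
    (proj₂ (covering i))
  where
  row-of : ∀ i → ∃[ b ] proj₁ (square t b) i ≡ w i → ∃[ c ] derangement (classOf₂ t c) i ≡ w i
  row-of i (zero  , i≡wi) = ⊥-elim (w-der i (sym i≡wi))
  row-of i (suc c , on-c) = c , on-c
  covering : ∀ i → ∃[ c ] derangement (classOf₂ t c) i ≡ w i
  covering i = row-of i (proj₁ (square-partition t) i (w i))
  avoids : ∀ i {c′} → (∀ i → w i ≢ derangement (classOf₂ t c′) i) → proj₁ (covering i) ≢ c′
  avoids i w≢ refl = w≢ i (sym (proj₂ (covering i)))

link-derangement : (x : V (Link S₅ idP)) → ∀ i → proj₁ (proj₁ x) i ≢ i
link-derangement (w , w≉id , (q , partition , (a , diag) ∷ (b , w≈qb) ∷ [])) i wi≡i =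
  diagonal-partner q partition diag a≢b i (trans (sym (w≈qb i)) wi≡i)
  where
  a≢b : a ≢ b
  a≢b refl = w≉id (λ i → trans (w≈qb i) (sym (diag i)))

index : V (Link S₅ idP) → Fin 44
index x = proj₁ (classify-derangement (proj₁ x) (link-derangement x))

index-correct : ∀ x i → derangement (index x) i ≡ proj₁ (proj₁ x) i
index-correct x = proj₂ (classify-derangement (proj₁ x) (link-derangement x))

-- The four partners of the diagonal  q a  in a grid partition q are
-- pairwise disjoint derangements; the first three lie in a common facet
-- t of T₂ (triple), and then so does the fourth (fourth-row).
module DiagonalPartners (q : Fin 5 → Perm5) (partition : IsGridPartition q)
                        (a : Fin 5) (diag : ∀ i → i ≡ proj₁ (q a) i) where

  partner : Fin 4 → Perm5
  partner j = q (punchIn a j)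

  partner-der : ∀ j i → proj₁ (partner j) i ≢ i
  partner-der j = diagonal-partner q partition diag (punchInᵢ≢i a j ∘ sym)

  partner-disjoint : ∀ j j′ → j ≢ j′ → ∀ i → proj₁ (partner j) i ≢ proj₁ (partner j′) i
  partner-disjoint j j′ j≢j′ i eq = j≢j′ (punchIn-injective a j j′ (proj₂ partition _ _ i eq))

  code : Fin 4 → Fin 44
  code j = proj₁ (classify-derangement (partner j) (partner-der j))

  code-correct : ∀ j i → derangement (code j) i ≡ proj₁ (partner j) i
  code-correct j = proj₂ (classify-derangement (partner j) (partner-der j))

  codes-disjoint : ∀ j j′ → j ≢ j′ → Disjoint (code j) (code j′)
  codes-disjoint j j′ j≢j′ i eq =
    partner-disjoint j j′ j≢j′ i (trans (sym (code-correct j i)) (trans eq (code-correct j′ i)))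

  j₀ j₁ j₂ j₃ : Fin 4
  j₀ = zero
  j₁ = suc zero
  j₂ = suc (suc zero)
  j₃ = suc (suc (suc zero))

  common : ∃[ t ] t ∈ facetsThrough (code j₀) × InRow (code j₀) t × InRow (code j₁) t × InRow (code j₂) t
  common = find (triple (code j₀) (code j₁) (codes-disjoint j₀ j₁ (λ ())) (code j₂)
                        (codes-disjoint j₀ j₂ (λ ())) (codes-disjoint j₁ j₂ (λ ())))

  facet : Fin 56
  facet = proj₁ common

  in₀ : InRow (code j₀) facet
  in₀ = proj₁ (proj₂ (proj₂ common))
  in₁ : InRow (code j₁) facet
  in₁ = proj₁ (proj₂ (proj₂ (proj₂ common)))
  in₂ : InRow (code j₂) facet
  in₂ = proj₂ (proj₂ (proj₂ (proj₂ common)))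

  distinct : ∀ {j j′ c c′} → j ≢ j′ →
             code j ≡ classOf₂ facet c → code j′ ≡ classOf₂ facet c′ → c ≢ c′
  distinct {j} {j′} j≢j′ e e′ refl =
    codes-disjoint j j′ j≢j′ zero (cong (λ k → derangement k zero) (trans e (sym e′)))

  off-row : ∀ {j c} → j ≢ j₃ → code j ≡ classOf₂ facet c →
            ∀ i → proj₁ (partner j₃) i ≢ derangement (classOf₂ facet c) i
  off-row {j} j≢j₃ e i eq = partner-disjoint j j₃ j≢j₃ i
    (trans (sym (code-correct j i)) (trans (cong (λ k → derangement k i) e) (sym eq)))

  fourth : ∃[ c ] ∀ i → derangement (classOf₂ facet c) i ≡ proj₁ (partner j₃) i
  fourth = fourth-row facet (distinct (λ ()) (proj₂ in₀) (proj₂ in₁))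
             (distinct (λ ()) (proj₂ in₀) (proj₂ in₂)) (distinct (λ ()) (proj₂ in₁) (proj₂ in₂))
             (proj₁ (partner j₃)) (partner-der j₃)
             (off-row (λ ()) (proj₂ in₀)) (off-row (λ ()) (proj₂ in₁)) (off-row (λ ()) (proj₂ in₂))

  in-facet : ∀ j → InRow (code j) facet
  in-facet zero                   = in₀
  in-facet (suc zero)             = in₁
  in-facet (suc (suc zero))       = in₂
  in-facet (suc (suc (suc zero))) = proj₁ fourth , derangement-injective _ _ (λ i →
    trans (code-correct j₃ i) (sym (proj₂ fourth i)))

-- Every face of the link lies in a facet of T₂: its vertices are partners
-- of the diagonal.
link-face-to : ∀ σ → Face (Link S₅ idP) σ → RowFace classOf₂ (map index σ)
link-face-to σ (q , partition , (a , diag) ∷ members) =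
  facet , AllP.map⁺ (All.map (λ {x} → locate x) (AllP.map⁻ members))
  where
  open DiagonalPartners q partition a diag
  locate : ∀ x → ∃[ b ] (∀ i → proj₁ (proj₁ x) i ≡ proj₁ (q b) i) → InRow (index x) facet
  locate x (b , x≈qb) = proj₁ (in-facet j) ,
    trans (derangement-injective _ _ (λ i → trans (index-correct x i) (trans (x≈qb i)
             (trans (cong (λ b → proj₁ (q b) i) (sym (punchIn-punchOut a≢b))) (sym (code-correct j i))))))
          (proj₂ (in-facet j))
    where
    a≢b : a ≢ b
    a≢b refl = proj₁ (proj₂ x) (λ i → trans (x≈qb i) (sym (diag i)))
    j : Fin 4
    j = punchOut a≢b

link-identity : Link S₅ idP ≅ T₂
link-identity = record
  { to        = index
  ; from      = vertex
  ; to-cong   = λ {x} {y} x≈y → derangement-injective _ _ (λ i →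
                  trans (index-correct x i) (trans (x≈y i) (sym (index-correct y i))))
  ; from-cong = λ { refl i → refl }
  ; from-to   = index-correct
  ; to-from   = λ k → derangement-injective _ _ (index-correct (vertex k))
  ; face-to   = link-face-to
  ; face-from = λ σ → λ { (t , rows) → square t , square-partition t , (zero , λ i → refl) ∷
      AllP.map⁺ (All.map (λ {x} → λ { (c , x↦c) → suc c , λ i →
        trans (sym (index-correct x i)) (cong (λ k → derangement k i) x↦c) }) (AllP.map⁻ rows)) }
  }
  where
  vertex : Fin 44 → V (Link S₅ idP)
  vertex k = derangementP k , (λ k≈id → proj₂ (derangement-facts k) zero (k≈id zero)) ,
    (square t , square-partition t , (zero , λ i → refl) ∷
       (suc c , λ i → cong (λ l → derangement l i) (sym t,c↦k)) ∷ [])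
    where
    t : Fin 56
    t = proj₁ (ColouringTable.classOf-onto table₂ k)
    c : Fin 4
    c = proj₁ (proj₂ (ColouringTable.classOf-onto table₂ k))
    t,c↦k : classOf₂ t c ≡ k
    t,c↦k = proj₂ (proj₂ (ColouringTable.classOf-onto table₂ k))

link≅T₂ : (p : V S₅) → Link S₅ p ≅ T₂
link≅T₂ p = ≅-trans (Link-setoid S₅-setoid p) T₂-setoid (link-to-identity p) link-identity

mainTheorem10 : ((p q : V S₅) → Link S₅ p ≅ Link S₅ q) × ((p : V S₅) → Link S₅ p ≅ B² 4 Icosahedron)
mainTheorem10 =
  (λ p q → ≅-trans (Link-setoid S₅-setoid p) (Link-setoid S₅-setoid q)
             (link≅T₂ p) (≅-sym T₂-setoid (link≅T₂ q))) ,
  (λ p → ≅-trans (Link-setoid S₅-setoid p) (B-setoid 4 (B 4 Icosahedron))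
           (link≅T₂ p) (≅-sym T₂-setoid B²-icosahedron))
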